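{- Let $k\ge 3$ and $n\ge 2$ be integers and let $\mathcal{H}_{k,n}$ be the hinge graph obtained by gluing $n$ copies of the $k$-cycle along one common edge. Then the critical group of $\mathcal{H}_{k,n}$ has order $$|K(\mathcal{H}_{k,n})|=(k-1)^{n-2}(k-1)(k+n-1).$$
   Context: The hinge graph $\mathcal{H}_{k,n}$ is the simple graph with two distinguished ("shared") vertices $x,y$ joined by an edge $xy$, together with $n$ internally vertex-disjoint paths from $x$ to $y$, each having $k-2$ internal vertices; equivalently, it is obtained from $n$ cycle graphs with $k$ vertices each by identifying one edge (and its two endpoints) of every cycle into a single common edge $xy$. For a finite connected graph $G$, a divisor is a formal $\mathbb{Z}$-linear combination of vertices; firing a vertex $w$ decreases its value by its valence and increases each neighbor's value by $1$; two divisors are linearly equivalent if one is obtained from the other by a sequence of firings and their inverses (i.e., their difference lies in the image of the graph Laplacian $L$). The critical group $K(G)$ is the group of degree-zero divisors modulo linear equivalence (the torsion part of $\operatorname{cok}(L)$). -}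

module Defs where

open import Data.Nat as ℕ using (ℕ; zero; suc; _∸_; _≟_)
open import Data.Integer as ℤ using (ℤ; +_; _-_)
open import Data.Fin using (Fin; toℕ)
open import Data.List using (List; []; _∷_; _++_; map; foldr; upTo; concatMap; length)
open import Data.List.Base using (allFin)
open import Data.Product using (Σ; ∃; _×_; _,_)
open import Data.Bool using (if_then_else_)
open import Relation.Nullary.Decidable using (⌊_⌋)
open import Relation.Binary.PropositionalEquality using (_≡_)

-- Finite graphs on vertex set Fin N, given by a list of edges.
-- Edges are pairs of natural numbers (vertex indices); an edge (a , b)
-- joins the vertices with toℕ-values a and b.

Edge : Set
Edge = ℕ × ℕ

countEdge : ℕ → ℕ → Edge → ℕ
countEdge u v (a , b) =
  (if ⌊ u ≟ a ⌋ Data.Bool.∧ ⌊ v ≟ b ⌋ then 1 else 0)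
  ℕ.+ (if ⌊ u ≟ b ⌋ Data.Bool.∧ ⌊ v ≟ a ⌋ then 1 else 0)

adj : {N : ℕ} → List Edge → Fin N → Fin N → ℕ
adj E u v = foldr (λ e s → countEdge (toℕ u) (toℕ v) e ℕ.+ s) 0 E

Σℤ : {N : ℕ} → (Fin N → ℤ) → ℤ
Σℤ {N} f = foldr ℤ._+_ (+ 0) (map f (allFin N))

valence : {N : ℕ} → List Edge → Fin N → ℕ
valence {N} E u = foldr ℕ._+_ 0 (map (adj E u) (allFin N))

Divisor : ℕ → Set
Divisor N = Fin N → ℤ

degree : {N : ℕ} → Divisor N → ℤ
degree D = Σℤ D

-- Laplacian applied to a firing vector z : (L z)(u) = val(u) z(u) - Σ_v adj(u,v) z(v)
-- (firing z(u) times each vertex u changes D into D - L z)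
laplacian : {N : ℕ} → List Edge → (Fin N → ℤ) → Divisor N
laplacian E z u = (+ valence E u) ℤ.* z u - Σℤ (λ v → (+ adj E u v) ℤ.* z v)

LinEquiv : {N : ℕ} → List Edge → Divisor N → Divisor N → Set
LinEquiv E D D' = ∃ λ z → ∀ u → D u - D' u ≡ laplacian E z u

-- The critical group K(G) (degree-zero divisors modulo linear equivalence)
-- has order m: there is a complete, irredundant system of m representatives.
CriticalGroupHasOrder : (N : ℕ) → List Edge → ℕ → Set
CriticalGroupHasOrder N E m =
  Σ (Fin m → Divisor N) λ f →
      (∀ i → degree (f i) ≡ + 0)
    × (∀ i j → LinEquiv E (f i) (f j) → i ≡ j)
    × (∀ (D : Divisor N) → degree D ≡ + 0 → ∃ λ i → LinEquiv E D (f i))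

-- The hinge graph H_{k,n}.
-- Vertices: x = 0, y = 1, and the j-th internal vertex (j < k-2) of the
-- i-th path (i < n) is 2 + i*(k-2) + j.  Total: 2 + n*(k-2) vertices.

hingeSize : ℕ → ℕ → ℕ
hingeSize k n = 2 ℕ.+ n ℕ.* (k ∸ 2)

internal : ℕ → ℕ → ℕ → ℕ
internal k i j = 2 ℕ.+ i ℕ.* (k ∸ 2) ℕ.+ j

chain : List ℕ → List Edge
chain [] = []
chain (a ∷ []) = []
chain (a ∷ b ∷ l) = (a , b) ∷ chain (b ∷ l)

pathEdges : ℕ → ℕ → List Edge
pathEdges k i = chain (0 ∷ (map (internal k i) (upTo (k ∸ 2)) ++ (1 ∷ [])))

hingeEdges : ℕ → ℕ → List Edge
hingeEdges k n = (0 , 1) ∷ concatMap (pathEdges k) (upTo n)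

-- With a = k - 1 edges per path, let P i be the divisor v - x for the neighbour v of x on path i.
-- A firing vector supported on the internal vertices of path i before position p shows that a chip
-- at distance p from x is equivalent to x + p P i. For p = a this gives y - x ~ a P i for every i,
-- and firing x gives y - x + ∑ P i ~ 0. Hence every divisor of degree 0 is equivalent to a normal
-- form c P 0 + ∑ f s (P (s + 1) - P 0) with c < a + n and f s < a.
-- Normal forms are pairwise inequivalent: summation by parts shows that a vertex weight increasing by
-- α i per edge of path i pairs with every principal divisor to a multiple of q, provided y carries the
-- weight Y with q ∣ Y - a α i and Y + ∑ α = 0. One choice of slopes reads off c - (a + n) f 0 modulo
-- a (a + n), hence c and f 0; others read off each f (s + 1) - f 0 modulo a. There are
-- (a + n) a ^ (n - 1) normal forms.

module Submission where

open import Defs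

-- Scopes the integer operators away from the natural-number ones in the statement of theorem3p1.
module _ where

  open import Data.Nat as ℕ using (ℕ; zero; suc; _∸_; _≟_; _<_; _≤_; _^_; z≤n; s≤s; NonZero)
  import Data.Nat.Properties as ℕP
  open import Data.Nat.DivMod using (_/_; _%_; [m+kn]%n≡m%n; m<n⇒m%n≡m; +-distrib-/-∣ˡ; m*n/n≡m; m<n⇒m/n≡0)
  open import Data.Nat.Divisibility using (n∣m*n; n∣m⇒m%n≡0)
  open import Data.Integer as ℤ using (ℤ; +_; -_; _+_; _*_; _-_; _/ℕ_; _%ℕ_)
  import Data.Integer.Properties as ℤP
  open import Data.Integer.DivMod using (a≡a%ℕn+[a/ℕn]*n; n%ℕd<d)
  open import Data.Integer.Divisibility.Signed
    using (_∣_; divides; ∣⇒∣ᵤ; ∣m∣n⇒∣m+n; ∣n⇒∣m*n; ∣-trans; *-cancelʳ-∣)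
  open import Data.Integer.Tactic.RingSolver using (solve-∀)
  open import Data.Fin using (Fin; toℕ; fromℕ<; combine; remQuot; finToFun; funToFin)
    renaming (zero to fzero; suc to fsuc)
  open import Data.Fin.Properties
    using (toℕ-injective; toℕ<n; fromℕ<-toℕ; toℕ-fromℕ<; remQuot-combine; combine-remQuot;
           finToFun-funToFin; funToFin-finToFin)
  open import Data.List using (List; []; _∷_; _++_; map; foldr; upTo; concatMap; applyUpTo; tabulate)
  open import Data.List.Base using (allFin)
  open import Data.List.Relation.Unary.All using (All; []; _∷_)
  import Data.List.Relation.Unary.All.Properties as All
  open import Data.Product using (∃; _×_; _,_; proj₁; proj₂)
  open import Data.Sum using (_⊎_; inj₁; inj₂)
  open import Data.Bool using (if_then_else_; _∧_)
  open import Data.Empty using (⊥-elim)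
  open import Function using (_∘_)
  open import Relation.Nullary using (yes; no)
  open import Relation.Nullary.Decidable using (⌊_⌋)
  open import Relation.Binary.PropositionalEquality

  ∑ : ℕ → (ℕ → ℤ) → ℤ
  ∑ zero    F = + 0
  ∑ (suc n) F = F 0 + ∑ n (F ∘ suc)

  ∑-cong : ∀ n {F G : ℕ → ℤ} → (∀ t → F t ≡ G t) → ∑ n F ≡ ∑ n G
  ∑-cong zero    eq = refl
  ∑-cong (suc n) eq = cong₂ _+_ (eq 0) (∑-cong n (eq ∘ suc))

  ∑-cong< : ∀ n {F G : ℕ → ℤ} → (∀ t → t < n → F t ≡ G t) → ∑ n F ≡ ∑ n G
  ∑-cong< zero    eq = refl
  ∑-cong< (suc n) eq = cong₂ _+_ (eq 0 (s≤s z≤n)) (∑-cong< n (λ t t<n → eq (suc t) (s≤s t<n)))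

  ∑-zero : ∀ n → ∑ n (λ _ → + 0) ≡ + 0
  ∑-zero zero    = refl
  ∑-zero (suc n) = trans (ℤP.+-identityˡ _) (∑-zero n)

  ∑-distrib-+ : ∀ n (F G : ℕ → ℤ) → ∑ n (λ t → F t + G t) ≡ ∑ n F + ∑ n G
  ∑-distrib-+ zero    F G = refl
  ∑-distrib-+ (suc n) F G rewrite ∑-distrib-+ n (F ∘ suc) (G ∘ suc) =
    interchange (F 0) (G 0) (∑ n (F ∘ suc)) (∑ n (G ∘ suc))
    where
    interchange : ∀ a b c d → a + b + (c + d) ≡ a + c + (b + d)
    interchange = solve-∀

  ∑-*ˡ : ∀ n c (F : ℕ → ℤ) → ∑ n (λ t → c * F t) ≡ c * ∑ n F
  ∑-*ˡ zero    c F = sym (ℤP.*-zeroʳ c)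
  ∑-*ˡ (suc n) c F rewrite ∑-*ˡ n c (F ∘ suc) = sym (ℤP.*-distribˡ-+ c (F 0) _)

  ∑-neg : ∀ n (F : ℕ → ℤ) → ∑ n (λ t → - F t) ≡ - ∑ n F
  ∑-neg zero    F = refl
  ∑-neg (suc n) F rewrite ∑-neg n (F ∘ suc) = sym (ℤP.neg-distrib-+ (F 0) _)

  ∑-distrib-− : ∀ n (F G : ℕ → ℤ) → ∑ n (λ t → F t - G t) ≡ ∑ n F - ∑ n G
  ∑-distrib-− n F G = trans (∑-distrib-+ n F (λ t → - G t)) (cong (_+_ (∑ n F)) (∑-neg n G))

  ∑-*ʳ : ∀ n c (F : ℕ → ℤ) → ∑ n (λ t → F t * c) ≡ ∑ n F * c
  ∑-*ʳ n c F = trans (∑-cong n (λ t → ℤP.*-comm (F t) c)) (trans (∑-*ˡ n c F) (ℤP.*-comm c _))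

  ∑-distrib-+₃ : ∀ n (F G H : ℕ → ℤ) → ∑ n (λ t → F t + G t + H t) ≡ ∑ n F + ∑ n G + ∑ n H
  ∑-distrib-+₃ n F G H = trans (∑-distrib-+ n (λ t → F t + G t) H) (cong (_+ ∑ n H) (∑-distrib-+ n F G))

  ∑-const : ∀ n x → ∑ n (λ _ → x) ≡ + n * x
  ∑-const zero    x = sym (ℤP.*-zeroˡ x)
  ∑-const (suc n) x = begin
    x + ∑ n (λ _ → x) ≡⟨ cong (_+_ x) (∑-const n x) ⟩
    x + + n * x       ≡⟨ sym (ℤP.suc-* (+ n) x) ⟩
    + suc n * x       ∎
    where open ≡-Reasoning

  ∑-split : ∀ m n (F : ℕ → ℤ) → ∑ (m ℕ.+ n) F ≡ ∑ m F + ∑ n (λ t → F (m ℕ.+ t))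
  ∑-split zero    n F = sym (ℤP.+-identityˡ _)
  ∑-split (suc m) n F rewrite ∑-split m n (F ∘ suc) = sym (ℤP.+-assoc (F 0) _ _)

  ∑-blocks : ∀ n m (F : ℕ → ℤ) → ∑ (n ℕ.* m) F ≡ ∑ n (λ i → ∑ m (λ j → F (i ℕ.* m ℕ.+ j)))
  ∑-blocks zero    m F = refl
  ∑-blocks (suc n) m F = trans (∑-split m (n ℕ.* m) F)
    (cong (_+_ (∑ m F)) (trans (∑-blocks n m (λ t → F (m ℕ.+ t)))
      (∑-cong n (λ i → ∑-cong m (λ j → cong F (sym (ℕP.+-assoc m (i ℕ.* m) j)))))))

  ∑-comm : ∀ m n (F : ℕ → ℕ → ℤ) → ∑ m (λ s → ∑ n (F s)) ≡ ∑ n (λ t → ∑ m (λ s → F s t))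
  ∑-comm zero    n F = sym (∑-zero n)
  ∑-comm (suc m) n F rewrite ∑-comm m n (F ∘ suc) = sym (∑-distrib-+ n (F 0) (λ t → ∑ m (λ s → F (suc s) t)))

  ∑-telescope : ∀ n (F : ℕ → ℤ) → ∑ n (λ p → F (suc p) - F p) ≡ F n - F 0
  ∑-telescope zero    F = sym (ℤP.+-inverseʳ (F 0))
  ∑-telescope (suc n) F = trans (cong (_+_ (F 1 - F 0)) (∑-telescope n (F ∘ suc))) (collapse (F 0) (F 1) (F (suc n)))
    where
    collapse : ∀ a b c → b - a + (c - b) ≡ c - a
    collapse = solve-∀

  ∑-prefix : ∀ n p (F : ℕ → ℤ) → p ≤ n → ∑ n (λ q → (+ (p ∸ q) - + (p ∸ suc q)) * F q) ≡ ∑ p F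
  ∑-prefix zero    zero    F _ = refl
  ∑-prefix (suc n) zero    F _ = trans (∑-cong (suc n) (λ q → trans
    (cong₂ (λ x y → (+ x - + y) * F q) (ℕP.0∸n≡0 q) (ℕP.0∸n≡0 (suc q))) (ℤP.*-zeroˡ (F q)))) (∑-zero (suc n))
  ∑-prefix (suc n) (suc p) F (s≤s p≤n) = cong₂ _+_
    (trans (cong (λ x → (x - + p) * F 0) (ℤP.pos-+ 1 p)) (cancel (+ p) (F 0)))
    (∑-prefix n p (F ∘ suc) p≤n)
    where
    cancel : ∀ x f → (+ 1 + x - x) * f ≡ f
    cancel = solve-∀

  ∑-rebase : ∀ n (X Y : ℕ → ℤ) →
    ∑ (suc n) (λ i → X i * Y i) ≡ ∑ (suc n) X * Y 0 + ∑ n (λ s → X (suc s) * (Y (suc s) - Y 0))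
  ∑-rebase n X Y = begin
    X 0 * Y 0 + ∑ n (λ s → X (suc s) * Y (suc s))
      ≡⟨ cong (_+_ (X 0 * Y 0)) (∑-cong n (λ s → split (X (suc s)) (Y (suc s)) (Y 0))) ⟩
    X 0 * Y 0 + ∑ n (λ s → X (suc s) * Y 0 + X (suc s) * (Y (suc s) - Y 0))
      ≡⟨ cong (_+_ (X 0 * Y 0)) (∑-distrib-+ n _ _) ⟩
    X 0 * Y 0 + (∑ n (λ s → X (suc s) * Y 0) + ∑ n (λ s → X (suc s) * (Y (suc s) - Y 0)))
      ≡⟨ cong (λ z → X 0 * Y 0 + (z + ∑ n (λ s → X (suc s) * (Y (suc s) - Y 0))))
           (trans (∑-cong n (λ s → ℤP.*-comm (X (suc s)) (Y 0))) (∑-*ˡ n (Y 0) (X ∘ suc))) ⟩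
    X 0 * Y 0 + (Y 0 * ∑ n (X ∘ suc) + ∑ n (λ s → X (suc s) * (Y (suc s) - Y 0)))
      ≡⟨ regroup (X 0) (Y 0) (∑ n (X ∘ suc)) (∑ n (λ s → X (suc s) * (Y (suc s) - Y 0))) ⟩
    (X 0 + ∑ n (X ∘ suc)) * Y 0 + ∑ n (λ s → X (suc s) * (Y (suc s) - Y 0)) ∎
    where
    open ≡-Reasoning
    split : ∀ x y y₀ → x * y ≡ x * y₀ + x * (y - y₀)
    split = solve-∀
    regroup : ∀ x₀ y₀ s r → x₀ * y₀ + (y₀ * s + r) ≡ (x₀ + s) * y₀ + r
    regroup = solve-∀

  δ : ℕ → ℕ → ℤ
  δ c t = if ⌊ t ≟ c ⌋ then + 1 else + 0

  δ-refl : ∀ c → δ c c ≡ + 1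
  δ-refl c with c ≟ c
  ... | yes _  = refl
  ... | no c≢c = ⊥-elim (c≢c refl)

  δ-≢ : ∀ c t → t ≢ c → δ c t ≡ + 0
  δ-≢ c t t≢c with t ≟ c
  ... | yes t≡c = ⊥-elim (t≢c t≡c)
  ... | no _    = refl

  δ-suc : ∀ c t → δ (suc c) (suc t) ≡ δ c t
  δ-suc c t with t ≟ c
  ... | yes refl = δ-refl (suc c)
  ... | no t≢c   = δ-≢ (suc c) (suc t) (t≢c ∘ ℕP.suc-injective)

  δ-sym : ∀ c t → δ c t ≡ δ t c
  δ-sym c t with t ≟ c
  ... | yes refl = sym (δ-refl c)
  ... | no t≢c   = sym (δ-≢ t c (t≢c ∘ sym))

  δ-* : ∀ c t (F : ℕ → ℤ) → δ c t * F t ≡ δ c t * F c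
  δ-* c t F with t ≟ c
  ... | yes refl = refl
  ... | no _     = refl

  ∑-δ : ∀ n {c} (F : ℕ → ℤ) → c < n → ∑ n (λ s → δ c s * F s) ≡ F c
  ∑-δ (suc n) {zero} F _ = begin
    δ 0 0 * F 0 + ∑ n (λ t → δ 0 (suc t) * F (suc t))
      ≡⟨ cong₂ _+_ (cong (_* F 0) (δ-refl 0)) (∑-cong n (λ t → cong (_* F (suc t)) (δ-≢ 0 (suc t) λ ()))) ⟩
    + 1 * F 0 + ∑ n (λ t → + 0 * F (suc t))
      ≡⟨ cong₂ _+_ (ℤP.*-identityˡ (F 0)) (∑-zero n) ⟩
    F 0 + + 0 ≡⟨ ℤP.+-identityʳ _ ⟩
    F 0       ∎
    where open ≡-Reasoning
  ∑-δ (suc n) {suc c} F (s≤s c<n) = begin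
    δ (suc c) 0 * F 0 + ∑ n (λ t → δ (suc c) (suc t) * F (suc t))
      ≡⟨ cong₂ _+_ (cong (_* F 0) (δ-≢ (suc c) 0 λ ())) (∑-cong n (λ t → cong (_* F (suc t)) (δ-suc c t))) ⟩
    + 0 + ∑ n (λ t → δ c t * F (suc t)) ≡⟨ ℤP.+-identityˡ _ ⟩
    ∑ n (λ t → δ c t * F (suc t))       ≡⟨ ∑-δ n (F ∘ suc) c<n ⟩
    F (suc c)                           ∎
    where open ≡-Reasoning

  ∑-δ′ : ∀ n {c} (F : ℕ → ℤ) → c < n → ∑ n (λ s → δ s c * F s) ≡ F c
  ∑-δ′ n {c} F c<n = trans (∑-cong n (λ s → cong (_* F s) (δ-sym s c))) (∑-δ n F c<n)

  ∑-δ-one : ∀ n {c} → c < n → ∑ n (δ c) ≡ + 1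
  ∑-δ-one n {c} c<n = trans (∑-cong n (λ s → sym (ℤP.*-identityʳ (δ c s)))) (∑-δ n (λ _ → + 1) c<n)

  ∑ₗ : {A : Set} → List A → (A → ℤ) → ℤ
  ∑ₗ []       f = + 0
  ∑ₗ (x ∷ xs) f = f x + ∑ₗ xs f

  ∑ₗ-cong : {A : Set} (l : List A) {f g : A → ℤ} → (∀ x → f x ≡ g x) → ∑ₗ l f ≡ ∑ₗ l g
  ∑ₗ-cong []      eq = refl
  ∑ₗ-cong (x ∷ l) eq = cong₂ _+_ (eq x) (∑ₗ-cong l eq)

  ∑ₗ-congᴬ : {A : Set} {P : A → Set} (l : List A) {f g : A → ℤ} →
    All P l → (∀ x → P x → f x ≡ g x) → ∑ₗ l f ≡ ∑ₗ l g
  ∑ₗ-congᴬ []      []         eq = refl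
  ∑ₗ-congᴬ (x ∷ l) (px ∷ pl) eq = cong₂ _+_ (eq x px) (∑ₗ-congᴬ l pl eq)

  ∑ₗ-distrib-+ : {A : Set} (l : List A) (f g : A → ℤ) → ∑ₗ l (λ x → f x + g x) ≡ ∑ₗ l f + ∑ₗ l g
  ∑ₗ-distrib-+ []      f g = refl
  ∑ₗ-distrib-+ (x ∷ l) f g rewrite ∑ₗ-distrib-+ l f g = interchange (f x) (g x) (∑ₗ l f) (∑ₗ l g)
    where
    interchange : ∀ a b c d → a + b + (c + d) ≡ a + c + (b + d)
    interchange = solve-∀

  ∑ₗ-*ˡ : {A : Set} (l : List A) (c : ℤ) (f : A → ℤ) → ∑ₗ l (λ x → c * f x) ≡ c * ∑ₗ l f
  ∑ₗ-*ˡ []      c f = sym (ℤP.*-zeroʳ c)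
  ∑ₗ-*ˡ (x ∷ l) c f rewrite ∑ₗ-*ˡ l c f = sym (ℤP.*-distribˡ-+ c (f x) _)

  ∑ₗ-*ʳ : {A : Set} (l : List A) (c : ℤ) (f : A → ℤ) → ∑ₗ l (λ x → f x * c) ≡ ∑ₗ l f * c
  ∑ₗ-*ʳ l c f = trans (∑ₗ-cong l (λ x → ℤP.*-comm (f x) c)) (trans (∑ₗ-*ˡ l c f) (ℤP.*-comm c _))

  ∑ₗ-neg : {A : Set} (l : List A) (f : A → ℤ) → ∑ₗ l (λ x → - f x) ≡ - ∑ₗ l f
  ∑ₗ-neg []      f = refl
  ∑ₗ-neg (x ∷ l) f rewrite ∑ₗ-neg l f = sym (ℤP.neg-distrib-+ (f x) _)

  ∑ₗ-distrib-− : {A : Set} (l : List A) (f g : A → ℤ) → ∑ₗ l (λ x → f x - g x) ≡ ∑ₗ l f - ∑ₗ l g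
  ∑ₗ-distrib-− l f g = trans (∑ₗ-distrib-+ l f (λ t → - g t)) (cong (_+_ (∑ₗ l f)) (∑ₗ-neg l g))

  ∑ₗ-++ : {A : Set} (l m : List A) (f : A → ℤ) → ∑ₗ (l ++ m) f ≡ ∑ₗ l f + ∑ₗ m f
  ∑ₗ-++ []      m f = sym (ℤP.+-identityˡ _)
  ∑ₗ-++ (x ∷ l) m f rewrite ∑ₗ-++ l m f = sym (ℤP.+-assoc (f x) _ _)

  ∑ₗ-concatMap : {A B : Set} (g : A → List B) (l : List A) (f : B → ℤ) →
    ∑ₗ (concatMap g l) f ≡ ∑ₗ l (λ x → ∑ₗ (g x) f)
  ∑ₗ-concatMap g []      f = refl
  ∑ₗ-concatMap g (x ∷ l) f = trans (∑ₗ-++ (g x) (concatMap g l) f) (cong (_+_ (∑ₗ (g x) f)) (∑ₗ-concatMap g l f))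

  ∑ₗ-applyUpTo : {A : Set} (g : ℕ → A) (n : ℕ) (f : A → ℤ) → ∑ₗ (applyUpTo g n) f ≡ ∑ n (f ∘ g)
  ∑ₗ-applyUpTo g zero    f = refl
  ∑ₗ-applyUpTo g (suc n) f = cong (_+_ (f (g 0))) (∑ₗ-applyUpTo (g ∘ suc) n f)

  ∑ₗ-∑-comm : {A : Set} (l : List A) (n : ℕ) (F : A → ℕ → ℤ) →
    ∑ₗ l (λ x → ∑ n (F x)) ≡ ∑ n (λ t → ∑ₗ l (λ x → F x t))
  ∑ₗ-∑-comm []      n F = sym (∑-zero n)
  ∑ₗ-∑-comm (x ∷ l) n F rewrite ∑ₗ-∑-comm l n F = sym (∑-distrib-+ n (F x) (λ t → ∑ₗ l (λ y → F y t)))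

  foldr-map-∑ₗ : {A : Set} (l : List A) (f : A → ℤ) → foldr _+_ (+ 0) (map f l) ≡ ∑ₗ l f
  foldr-map-∑ₗ []      f = refl
  foldr-map-∑ₗ (x ∷ l) f = cong (_+_ (f x)) (foldr-map-∑ₗ l f)

  foldr-map-ℕ : {A : Set} (l : List A) (f : A → ℕ) → + foldr ℕ._+_ 0 (map f l) ≡ ∑ₗ l (λ x → + f x)
  foldr-map-ℕ []      f = refl
  foldr-map-ℕ (x ∷ l) f = trans (ℤP.pos-+ (f x) _) (cong (_+_ (+ f x)) (foldr-map-ℕ l f))

  ∑ₗ-tabulate : ∀ {A : Set} N (g : Fin N → A) (f : A → ℤ) (F : ℕ → ℤ) →
    (∀ u → f (g u) ≡ F (toℕ u)) → ∑ₗ (tabulate g) f ≡ ∑ N F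
  ∑ₗ-tabulate zero    g f F eq = refl
  ∑ₗ-tabulate (suc N) g f F eq = cong₂ _+_ (eq fzero) (∑ₗ-tabulate N (g ∘ fsuc) f (F ∘ suc) (eq ∘ fsuc))

  ∑ₗ-allFin : ∀ N (f : Fin N → ℤ) (F : ℕ → ℤ) → (∀ u → f u ≡ F (toℕ u)) → ∑ₗ (allFin N) f ≡ ∑ N F
  ∑ₗ-allFin N = ∑ₗ-tabulate N (λ u → u)

  Σℤ≡∑ : ∀ N (f : Fin N → ℤ) (F : ℕ → ℤ) → (∀ u → f u ≡ F (toℕ u)) → Σℤ f ≡ ∑ N F
  Σℤ≡∑ N f F eq = trans (foldr-map-∑ₗ (allFin N) f) (∑ₗ-allFin N f F eq)

  EdgesBelow : ℕ → List Edge → Set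
  EdgesBelow N = All (λ (a , b) → a < N × b < N)

  Δ : List Edge → (ℕ → ℤ) → ℕ → ℤ
  Δ E Z t = ∑ₗ E (λ (a , b) → (Z b - Z a) * (δ b t - δ a t))

  adjℕ : List Edge → ℕ → ℕ → ℕ
  adjℕ E t s = foldr (λ e acc → countEdge t s e ℕ.+ acc) 0 E

  countEdge≡δ : ∀ t s a b → + countEdge t s (a , b) ≡ δ a t * δ b s + δ b t * δ a s
  countEdge≡δ t s a b = trans (ℤP.pos-+ (both t a s b) (both t b s a)) (cong₂ _+_ (both≡δ t a s b) (both≡δ t b s a))
    where
    both : ℕ → ℕ → ℕ → ℕ → ℕ
    both t a s b = if ⌊ t ≟ a ⌋ ∧ ⌊ s ≟ b ⌋ then 1 else 0
    both≡δ : ∀ t a s b → + both t a s b ≡ δ a t * δ b s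
    both≡δ t a s b with t ≟ a | s ≟ b
    ... | yes _ | yes _ = refl
    ... | yes _ | no _  = refl
    ... | no _  | yes _ = refl
    ... | no _  | no _  = refl

  adjℕ≡∑ₗ : ∀ E t s → + adjℕ E t s ≡ ∑ₗ E (λ e → + countEdge t s e)
  adjℕ≡∑ₗ []      t s = refl
  adjℕ≡∑ₗ (e ∷ E) t s = trans (ℤP.pos-+ (countEdge t s e) _) (cong (_+_ (+ countEdge t s e)) (adjℕ≡∑ₗ E t s))

  ∑-adjℕ : ∀ N E t (Z : ℕ → ℤ) → EdgesBelow N E →
    ∑ N (λ s → + adjℕ E t s * Z s) ≡ ∑ₗ E (λ (a , b) → δ a t * Z b + δ b t * Z a)
  ∑-adjℕ N E t Z below = begin
    ∑ N (λ s → + adjℕ E t s * Z s)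
      ≡⟨ ∑-cong N (λ s → trans (cong (_* Z s) (adjℕ≡∑ₗ E t s)) (sym (∑ₗ-*ʳ E (Z s) _))) ⟩
    ∑ N (λ s → ∑ₗ E (λ e → + countEdge t s e * Z s))
      ≡⟨ sym (∑ₗ-∑-comm E N (λ e s → + countEdge t s e * Z s)) ⟩
    ∑ₗ E (λ e → ∑ N (λ s → + countEdge t s e * Z s))
      ≡⟨ ∑ₗ-congᴬ E below perEdge ⟩
    ∑ₗ E (λ (a , b) → δ a t * Z b + δ b t * Z a) ∎
    where
    open ≡-Reasoning
    expand : ∀ p q r s w → (p * q + r * s) * w ≡ p * (q * w) + r * (s * w)
    expand = solve-∀
    perEdge : ∀ e → proj₁ e < N × proj₂ e < N →
      ∑ N (λ s → + countEdge t s e * Z s) ≡ δ (proj₁ e) t * Z (proj₂ e) + δ (proj₂ e) t * Z (proj₁ e)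
    perEdge (a , b) (a<N , b<N) = begin
      ∑ N (λ s → + countEdge t s (a , b) * Z s)
        ≡⟨ ∑-cong N (λ s → trans (cong (_* Z s) (countEdge≡δ t s a b)) (expand (δ a t) (δ b s) (δ b t) (δ a s) (Z s))) ⟩
      ∑ N (λ s → δ a t * (δ b s * Z s) + δ b t * (δ a s * Z s))
        ≡⟨ ∑-distrib-+ N _ _ ⟩
      ∑ N (λ s → δ a t * (δ b s * Z s)) + ∑ N (λ s → δ b t * (δ a s * Z s))
        ≡⟨ cong₂ _+_ (∑-*ˡ N (δ a t) _) (∑-*ˡ N (δ b t) _) ⟩
      δ a t * ∑ N (λ s → δ b s * Z s) + δ b t * ∑ N (λ s → δ a s * Z s)
        ≡⟨ cong₂ (λ x y → δ a t * x + δ b t * y) (∑-δ N Z b<N) (∑-δ N Z a<N) ⟩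
      δ a t * Z b + δ b t * Z a ∎

  valence≡∑ₗ : ∀ {N} E (u : Fin N) → EdgesBelow N E →
    + valence E u ≡ ∑ₗ E (λ (a , b) → δ a (toℕ u) + δ b (toℕ u))
  valence≡∑ₗ {N} E u below = begin
    + valence E u
      ≡⟨ foldr-map-ℕ (allFin N) (adj E u) ⟩
    ∑ₗ (allFin N) (λ v → + adj E u v)
      ≡⟨ ∑ₗ-allFin N _ (λ s → + adjℕ E (toℕ u) s * + 1) (λ v → sym (ℤP.*-identityʳ _)) ⟩
    ∑ N (λ s → + adjℕ E (toℕ u) s * + 1)
      ≡⟨ ∑-adjℕ N E (toℕ u) (λ _ → + 1) below ⟩
    ∑ₗ E (λ (a , b) → δ a (toℕ u) * + 1 + δ b (toℕ u) * + 1)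
      ≡⟨ ∑ₗ-cong E (λ (a , b) → cong₂ _+_ (ℤP.*-identityʳ (δ a (toℕ u))) (ℤP.*-identityʳ (δ b (toℕ u)))) ⟩
    ∑ₗ E (λ (a , b) → δ a (toℕ u) + δ b (toℕ u)) ∎
    where open ≡-Reasoning

  laplacian≡Δ : ∀ {N} E (z : Fin N → ℤ) (Z : ℕ → ℤ) → (∀ v → z v ≡ Z (toℕ v)) → EdgesBelow N E →
    ∀ u → laplacian E z u ≡ Δ E Z (toℕ u)
  laplacian≡Δ {N} E z Z z≡Z below u = begin
    + valence E u * z u - Σℤ (λ v → + adj E u v * z v)
      ≡⟨ cong₂ _-_ (cong₂ _*_ (valence≡∑ₗ E u below) (z≡Z u))
                   (trans (Σℤ≡∑ N _ (λ s → + adjℕ E t s * Z s) (λ v → cong (_*_ (+ adj E u v)) (z≡Z v)))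
                          (∑-adjℕ N E t Z below)) ⟩
    ∑ₗ E (λ (a , b) → δ a t + δ b t) * Z t - ∑ₗ E (λ (a , b) → δ a t * Z b + δ b t * Z a)
      ≡⟨ cong (_- ∑ₗ E (λ (a , b) → δ a t * Z b + δ b t * Z a)) (sym (∑ₗ-*ʳ E (Z t) _)) ⟩
    ∑ₗ E (λ (a , b) → (δ a t + δ b t) * Z t) - ∑ₗ E (λ (a , b) → δ a t * Z b + δ b t * Z a)
      ≡⟨ sym (∑ₗ-distrib-− E _ _) ⟩
    ∑ₗ E (λ (a , b) → (δ a t + δ b t) * Z t - (δ a t * Z b + δ b t * Z a))
      ≡⟨ ∑ₗ-cong E perEdge ⟩
    Δ E Z t ∎
    where
    open ≡-Reasoning
    t : ℕ
    t = toℕ u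
    rearrange : ∀ p q x y → (p * x + q * y) - (p * y + q * x) ≡ (y - x) * (q - p)
    rearrange = solve-∀
    perEdge : ∀ e → (δ (proj₁ e) t + δ (proj₂ e) t) * Z t - (δ (proj₁ e) t * Z (proj₂ e) + δ (proj₂ e) t * Z (proj₁ e))
                  ≡ (Z (proj₂ e) - Z (proj₁ e)) * (δ (proj₂ e) t - δ (proj₁ e) t)
    perEdge (a , b) = begin
      (δ a t + δ b t) * Z t - (δ a t * Z b + δ b t * Z a)
        ≡⟨ cong (_- (δ a t * Z b + δ b t * Z a)) (ℤP.*-distribʳ-+ (Z t) (δ a t) (δ b t)) ⟩
      (δ a t * Z t + δ b t * Z t) - (δ a t * Z b + δ b t * Z a)
        ≡⟨ cong₂ (λ x y → (x + y) - (δ a t * Z b + δ b t * Z a)) (δ-* a t Z) (δ-* b t Z) ⟩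
      (δ a t * Z a + δ b t * Z b) - (δ a t * Z b + δ b t * Z a)
        ≡⟨ rearrange (δ a t) (δ b t) (Z a) (Z b) ⟩
      (Z b - Z a) * (δ b t - δ a t) ∎

  Δ-+ : ∀ E (Z₁ Z₂ : ℕ → ℤ) t → Δ E (λ v → Z₁ v + Z₂ v) t ≡ Δ E Z₁ t + Δ E Z₂ t
  Δ-+ E Z₁ Z₂ t = trans (∑ₗ-cong E (λ (a , b) → split (Z₁ b) (Z₁ a) (Z₂ b) (Z₂ a) (δ b t - δ a t))) (∑ₗ-distrib-+ E _ _)
    where
    split : ∀ x₁ y₁ x₂ y₂ w → (x₁ + x₂ - (y₁ + y₂)) * w ≡ (x₁ - y₁) * w + (x₂ - y₂) * w
    split = solve-∀

  Δ-− : ∀ E (Z₁ Z₂ : ℕ → ℤ) t → Δ E (λ v → Z₁ v - Z₂ v) t ≡ Δ E Z₁ t - Δ E Z₂ t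
  Δ-− E Z₁ Z₂ t = trans (∑ₗ-cong E (λ (a , b) → split (Z₁ b) (Z₁ a) (Z₂ b) (Z₂ a) (δ b t - δ a t))) (∑ₗ-distrib-− E _ _)
    where
    split : ∀ x₁ y₁ x₂ y₂ w → (x₁ - x₂ - (y₁ - y₂)) * w ≡ (x₁ - y₁) * w - (x₂ - y₂) * w
    split = solve-∀

  Δ-* : ∀ E c (Z : ℕ → ℤ) t → Δ E (λ v → c * Z v) t ≡ c * Δ E Z t
  Δ-* E c Z t = trans (∑ₗ-cong E (λ (a , b) → factor c (Z b) (Z a) (δ b t - δ a t))) (∑ₗ-*ˡ E c _)
    where
    factor : ∀ c x y w → (c * x - c * y) * w ≡ c * ((x - y) * w)
    factor = solve-∀

  Δ-∑ : ∀ E n (Z : ℕ → ℕ → ℤ) t → Δ E (λ v → ∑ n (λ s → Z s v)) t ≡ ∑ n (λ s → Δ E (Z s) t)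
  Δ-∑ E n Z t = trans (∑ₗ-cong E perEdge) (∑ₗ-∑-comm E n (λ (a , b) s → (Z s b - Z s a) * (δ b t - δ a t)))
    where
    open ≡-Reasoning
    perEdge : ∀ e → (∑ n (λ s → Z s (proj₂ e)) - ∑ n (λ s → Z s (proj₁ e))) * (δ (proj₂ e) t - δ (proj₁ e) t)
                  ≡ ∑ n (λ s → (Z s (proj₂ e) - Z s (proj₁ e)) * (δ (proj₂ e) t - δ (proj₁ e) t))
    perEdge (a , b) = begin
      (∑ n (λ s → Z s b) - ∑ n (λ s → Z s a)) * w ≡⟨ cong (_* w) (sym (∑-distrib-− n _ _)) ⟩
      ∑ n (λ s → Z s b - Z s a) * w               ≡⟨ ℤP.*-comm _ w ⟩
      w * ∑ n (λ s → Z s b - Z s a)               ≡⟨ sym (∑-*ˡ n w _) ⟩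
      ∑ n (λ s → w * (Z s b - Z s a))             ≡⟨ ∑-cong n (λ s → ℤP.*-comm w _) ⟩
      ∑ n (λ s → (Z s b - Z s a) * w)             ∎
      where
      w : ℤ
      w = δ b t - δ a t

  ∑-*-Δ : ∀ N E (W Z : ℕ → ℤ) → EdgesBelow N E →
    ∑ N (λ t → W t * Δ E Z t) ≡ ∑ₗ E (λ (a , b) → (Z b - Z a) * (W b - W a))
  ∑-*-Δ N E W Z below = begin
    ∑ N (λ t → W t * Δ E Z t)
      ≡⟨ ∑-cong N (λ t → sym (∑ₗ-*ˡ E (W t) _)) ⟩
    ∑ N (λ t → ∑ₗ E (λ (a , b) → W t * ((Z b - Z a) * (δ b t - δ a t))))
      ≡⟨ sym (∑ₗ-∑-comm E N _) ⟩
    ∑ₗ E (λ (a , b) → ∑ N (λ t → W t * ((Z b - Z a) * (δ b t - δ a t))))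
      ≡⟨ ∑ₗ-congᴬ E below perEdge ⟩
    ∑ₗ E (λ (a , b) → (Z b - Z a) * (W b - W a)) ∎
    where
    open ≡-Reasoning
    regroup : ∀ w c x y → w * (c * (x - y)) ≡ c * (x * w - y * w)
    regroup = solve-∀
    perEdge : ∀ e → proj₁ e < N × proj₂ e < N →
      ∑ N (λ t → W t * ((Z (proj₂ e) - Z (proj₁ e)) * (δ (proj₂ e) t - δ (proj₁ e) t)))
        ≡ (Z (proj₂ e) - Z (proj₁ e)) * (W (proj₂ e) - W (proj₁ e))
    perEdge (a , b) (a<N , b<N) = begin
      ∑ N (λ t → W t * ((Z b - Z a) * (δ b t - δ a t)))
        ≡⟨ ∑-cong N (λ t → regroup (W t) (Z b - Z a) (δ b t) (δ a t)) ⟩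
      ∑ N (λ t → (Z b - Z a) * (δ b t * W t - δ a t * W t))
        ≡⟨ ∑-*ˡ N (Z b - Z a) _ ⟩
      (Z b - Z a) * ∑ N (λ t → δ b t * W t - δ a t * W t)
        ≡⟨ cong (_*_ (Z b - Z a)) (trans (∑-distrib-− N _ _) (cong₂ _-_ (∑-δ N W b<N) (∑-δ N W a<N))) ⟩
      (Z b - Z a) * (W b - W a) ∎

  ∣-∑ : ∀ {q} n (F : ℕ → ℤ) → (∀ i → i < n → q ∣ F i) → q ∣ ∑ n F
  ∣-∑ zero    F q∣F = divides (+ 0) refl
  ∣-∑ (suc n) F q∣F = ∣m∣n⇒∣m+n (q∣F 0 (s≤s z≤n)) (∣-∑ n (F ∘ suc) (λ i i<n → q∣F (suc i) (s≤s i<n)))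

  ∣-diff-<⇒≡ : ∀ {m x y} → x < m → y < m → + m ∣ + x - + y → x ≡ y
  ∣-diff-<⇒≡ {m} {x} {y} x<m y<m m∣x-y = ℤP.+-injective (ℤP.i-j≡0⇒i≡j (+ x) (+ y) (ℤP.∣i∣≡0⇒i≡0 d≡0))
    where
    instance
      m≢0 : NonZero m
      m≢0 = ℕ.>-nonZero (ℕP.<-≤-trans (s≤s z≤n) x<m)
    d : ℕ
    d = ℤ.∣ + x - + y ∣
    d<m : d < m
    d<m = ℕP.<-≤-trans (s≤s (subst (ℕ._≤ x ℕ.⊔ y) (cong ℤ.∣_∣ (sym (ℤP.m-n≡m⊖n x y))) (ℤP.∣m⊝n∣≤m⊔n x y)))
                       (ℕP.⊔-lub x<m y<m)
    d≡0 : d ≡ 0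
    d≡0 = trans (sym (m<n⇒m%n≡m d<m)) (n∣m⇒m%n≡0 d m (∣⇒∣ᵤ m∣x-y))

  orY : ℕ → ℕ → ℕ → ℕ
  orY zero    j       v = 1
  orY (suc m) zero    v = v
  orY (suc m) (suc j) v = orY m j v

  orY-< : ∀ m j v → j < m → orY m j v ≡ v
  orY-< (suc m) zero    v _         = refl
  orY-< (suc m) (suc j) v (s≤s j<m) = orY-< m j v j<m

  orY-≡ : ∀ m v → orY m m v ≡ 1
  orY-≡ zero    v = refl
  orY-≡ (suc m) v = orY-≡ m v

  orY-cases : ∀ m j v → orY m j v ≡ 1 ⊎ (j < m × orY m j v ≡ v)
  orY-cases zero    j       v = inj₁ refl
  orY-cases (suc m) zero    v = inj₂ (s≤s z≤n , refl)
  orY-cases (suc m) (suc j) v with orY-cases m j v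
  ... | inj₁ eq          = inj₁ eq
  ... | inj₂ (j<m , eq)  = inj₂ (s≤s j<m , eq)

  -- Position p along path i of the hinge with m internal vertices per path: x at p = 0, y at p = m + 1.
  pathVertex : ℕ → ℕ → ℕ → ℕ
  pathVertex m i zero    = 0
  pathVertex m i (suc j) = orY m j (internal (2 ℕ.+ m) i j)

  pathVertex-internal : ∀ m i j → j < m → pathVertex m i (suc j) ≡ internal (2 ℕ.+ m) i j
  pathVertex-internal m i j = orY-< m j _

  pathVertex-y : ∀ m i → pathVertex m i (suc m) ≡ 1
  pathVertex-y m i = orY-≡ m _

  pathVertex< : ∀ m n i p → i < n → pathVertex m i p < 2 ℕ.+ n ℕ.* m
  pathVertex< m n i zero    i<n = s≤s z≤n
  pathVertex< m n i (suc j) i<n with orY-cases m j (internal (2 ℕ.+ m) i j)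
  ... | inj₁ eq         = subst (_< 2 ℕ.+ n ℕ.* m) (sym eq) (s≤s (s≤s z≤n))
  ... | inj₂ (j<m , eq) = subst (_< 2 ℕ.+ n ℕ.* m) (sym eq) (s≤s (s≤s (begin-strict
    i ℕ.* m ℕ.+ j <⟨ ℕP.+-monoʳ-< (i ℕ.* m) j<m ⟩
    i ℕ.* m ℕ.+ m ≡⟨ ℕP.+-comm (i ℕ.* m) m ⟩
    suc i ℕ.* m   ≤⟨ ℕP.*-monoˡ-≤ m i<n ⟩
    n ℕ.* m       ∎)))
    where open ℕP.≤-Reasoning

  map-applyUpTo : {A B : Set} (f : A → B) (g : ℕ → A) (m : ℕ) → map f (applyUpTo g m) ≡ applyUpTo (f ∘ g) m
  map-applyUpTo f g zero    = refl
  map-applyUpTo f g (suc m) = cong (f (g 0) ∷_) (map-applyUpTo f (g ∘ suc) m)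

  applyUpTo-++-[] : {A : Set} (f g : ℕ → A) (y : A) (m : ℕ) →
    (∀ j → j < m → g j ≡ f j) → g m ≡ y → applyUpTo f m ++ (y ∷ []) ≡ applyUpTo g (suc m)
  applyUpTo-++-[] f g y zero    eq gm≡y = cong (_∷ []) (sym gm≡y)
  applyUpTo-++-[] f g y (suc m) eq gm≡y = cong₂ _∷_ (sym (eq 0 (s≤s z≤n)))
    (applyUpTo-++-[] (f ∘ suc) (g ∘ suc) y m (λ j j<m → eq (suc j) (s≤s j<m)) gm≡y)

  chain-applyUpTo : (h : ℕ → ℕ) (m : ℕ) → chain (applyUpTo h (suc m)) ≡ applyUpTo (λ p → (h p , h (suc p))) m
  chain-applyUpTo h zero    = refl
  chain-applyUpTo h (suc m) = cong ((h 0 , h 1) ∷_) (chain-applyUpTo (h ∘ suc) m)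

  pathEdges≡ : ∀ m i → pathEdges (2 ℕ.+ m) i ≡ applyUpTo (λ p → (pathVertex m i p , pathVertex m i (suc p))) (suc m)
  pathEdges≡ m i = trans
    (cong (λ l → chain (0 ∷ l)) (trans
      (cong (_++ (1 ∷ [])) (map-applyUpTo (internal (2 ℕ.+ m) i) (λ j → j) m))
      (applyUpTo-++-[] (internal (2 ℕ.+ m) i) (pathVertex m i ∘ suc) 1 m (pathVertex-internal m i) (pathVertex-y m i))))
    (chain-applyUpTo (pathVertex m i) (suc m))

  ∑ₗ-hingeEdges : ∀ m n (F : Edge → ℤ) → ∑ₗ (hingeEdges (2 ℕ.+ m) n) F ≡
    F (0 , 1) + ∑ n (λ i → ∑ (suc m) (λ p → F (pathVertex m i p , pathVertex m i (suc p))))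
  ∑ₗ-hingeEdges m n F = cong (_+_ (F (0 , 1))) (begin
    ∑ₗ (concatMap (pathEdges (2 ℕ.+ m)) (upTo n)) F    ≡⟨ ∑ₗ-concatMap (pathEdges (2 ℕ.+ m)) (upTo n) F ⟩
    ∑ₗ (upTo n) (λ i → ∑ₗ (pathEdges (2 ℕ.+ m) i) F)  ≡⟨ ∑ₗ-applyUpTo (λ i → i) n _ ⟩
    ∑ n (λ i → ∑ₗ (pathEdges (2 ℕ.+ m) i) F)          ≡⟨ ∑-cong n (λ i → trans (cong (λ l → ∑ₗ l F) (pathEdges≡ m i))
                                                            (∑ₗ-applyUpTo (λ p → (pathVertex m i p , pathVertex m i (suc p))) (suc m) F)) ⟩
    ∑ n (λ i → ∑ (suc m) (λ p → F (pathVertex m i p , pathVertex m i (suc p)))) ∎)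
    where open ≡-Reasoning

  All-concatMap-applyUpTo : {A B : Set} {P : B → Set} (g : A → List B) (f : ℕ → A) (n : ℕ) →
    (∀ i → i < n → All P (g (f i))) → All P (concatMap g (applyUpTo f n))
  All-concatMap-applyUpTo g f zero    all = []
  All-concatMap-applyUpTo g f (suc n) all =
    All.++⁺ (all 0 (s≤s z≤n)) (All-concatMap-applyUpTo g (f ∘ suc) n (λ i i<n → all (suc i) (s≤s i<n)))

  hingeEdgesBelow : ∀ m n → EdgesBelow (2 ℕ.+ n ℕ.* m) (hingeEdges (2 ℕ.+ m) n)
  hingeEdgesBelow m n = (s≤s z≤n , s≤s (s≤s z≤n)) ∷ All-concatMap-applyUpTo (pathEdges (2 ℕ.+ m)) (λ i → i) n
    (λ i i<n → subst (All _) (sym (pathEdges≡ m i))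
      (All.applyUpTo⁺₁ _ (suc m) (λ {p} _ → pathVertex< m n i p i<n , pathVertex< m n i (suc p) i<n)))

  onPaths : (m : ℕ) .{{_ : NonZero m}} → ℤ → ℤ → (ℕ → ℕ → ℤ) → ℕ → ℤ
  onPaths m X Y G zero          = X
  onPaths m X Y G (suc zero)    = Y
  onPaths m X Y G (suc (suc r)) = G (r / m) (r % m)

  onPaths-internal : ∀ m .{{_ : NonZero m}} X Y G i j → j < m → onPaths m X Y G (internal (2 ℕ.+ m) i j) ≡ G i j
  onPaths-internal m X Y G i j j<m = cong₂ G quotient remainder
    where
    quotient : (i ℕ.* m ℕ.+ j) / m ≡ i
    quotient = begin
      (i ℕ.* m ℕ.+ j) / m       ≡⟨ +-distrib-/-∣ˡ j (n∣m*n i) ⟩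
      i ℕ.* m / m ℕ.+ j / m     ≡⟨ cong₂ ℕ._+_ (m*n/n≡m i m) (m<n⇒m/n≡0 j<m) ⟩
      i ℕ.+ 0                   ≡⟨ ℕP.+-identityʳ i ⟩
      i                         ∎
      where open ≡-Reasoning
    remainder : (i ℕ.* m ℕ.+ j) % m ≡ j
    remainder = trans (cong (_% m) (ℕP.+-comm (i ℕ.* m) j)) (trans ([m+kn]%n≡m%n j i m) (m<n⇒m%n≡m j<m))

  onPaths-pathVertex : ∀ m .{{_ : NonZero m}} X Y G i j → j < m → onPaths m X Y G (pathVertex m i (suc j)) ≡ G i j
  onPaths-pathVertex m X Y G i j j<m = trans (cong (onPaths m X Y G) (pathVertex-internal m i j j<m)) (onPaths-internal m X Y G i j j<m)

  onPaths-y : ∀ m .{{_ : NonZero m}} X Y G i → onPaths m X Y G (pathVertex m i (suc m)) ≡ Y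
  onPaths-y m X Y G i = cong (onPaths m X Y G) (pathVertex-y m i)

  module Hinge (m n : ℕ) .{{_ : NonZero m}} where

    a N : ℕ
    a = suc m
    N = 2 ℕ.+ n ℕ.* m

    E : List Edge
    E = hingeEdges (2 ℕ.+ m) n

    v : ℕ → ℕ → ℕ
    v = pathVertex m

    stepδ : ℕ → ℕ → ℕ → ℤ
    stepδ i p t = δ (v i (suc p)) t - δ (v i p) t

    Δ-hinge : ∀ Z (φ : ℕ → ℕ → ℤ) → (∀ i p → p ≤ a → Z (v i p) ≡ φ i p) → ∀ t →
      Δ E Z t ≡ (Z 1 - Z 0) * (δ 1 t - δ 0 t) + ∑ n (λ i → ∑ a (λ p → (φ i (suc p) - φ i p) * stepδ i p t))
    Δ-hinge Z φ Z≡φ t = trans (∑ₗ-hingeEdges m n (λ (b , c) → (Z c - Z b) * (δ c t - δ b t)))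
      (cong (_+_ ((Z 1 - Z 0) * (δ 1 t - δ 0 t))) (∑-cong n (λ i → ∑-cong< a (λ p p<a →
        cong (_* stepδ i p t) (cong₂ _-_ (Z≡φ i (suc p) p<a) (Z≡φ i p (ℕP.<⇒≤ p<a)))))))

    -- Summation by parts turns ∑ W * Δ Z into (Z y - Z x) (Y + ∑ α) modulo q.
    module Invariant (Y q : ℤ) (α : ℕ → ℤ)
      (q∣Y-αa : ∀ i → i < n → q ∣ Y - α i * + a)
      (Y+∑α≡0 : Y + ∑ n α ≡ + 0) where

      W : ℕ → ℤ
      W = onPaths m (+ 0) Y (λ i j → α i * + suc j)

      W-pathVertex : ∀ i p → p ≤ m → W (v i p) ≡ α i * + p
      W-pathVertex i zero    _   = sym (ℤP.*-zeroʳ (α i))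
      W-pathVertex i (suc j) j<m = onPaths-pathVertex m (+ 0) Y _ i j j<m

      q∣W-step : ∀ i → i < n → ∀ p → p < a → q ∣ (W (v i (suc p)) - W (v i p)) - α i
      q∣W-step i i<n p (s≤s p≤m) with ℕP.m≤n⇒m<n∨m≡n p≤m
      ... | inj₁ p<m = divides (+ 0) (begin
        (W (v i (suc p)) - W (v i p)) - α i
          ≡⟨ cong₂ (λ x y → (x - y) - α i) (W-pathVertex i (suc p) p<m) (W-pathVertex i p (ℕP.<⇒≤ p<m)) ⟩
        (α i * + suc p - α i * + p) - α i ≡⟨ cong (λ x → (α i * x - α i * + p) - α i) (ℤP.pos-+ 1 p) ⟩
        (α i * (+ 1 + + p) - α i * + p) - α i ≡⟨ cancel (α i) (+ p) ⟩
        + 0 * q ∎)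
        where
        open ≡-Reasoning
        cancel : ∀ x p → (x * (+ 1 + p) - x * p) - x ≡ + 0 * q
        cancel = solve-∀
      ... | inj₂ refl = subst (q ∣_) (begin
        Y - α i * + suc p           ≡⟨ cong (λ x → Y - α i * x) (ℤP.pos-+ 1 p) ⟩
        Y - α i * (+ 1 + + p)       ≡⟨ regroup Y (α i) (+ p) ⟩
        (Y - α i * + p) - α i       ≡⟨ cong₂ (λ x y → (x - y) - α i) (sym (onPaths-y m (+ 0) Y _ i))
                                                                        (sym (W-pathVertex i p ℕP.≤-refl)) ⟩
        (W (v i (suc p)) - W (v i p)) - α i ∎) (q∣Y-αa i i<n)
        where
        open ≡-Reasoning
        regroup : ∀ y x p → y - x * (+ 1 + p) ≡ (y - x * p) - x
        regroup = solve-∀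

      q∣∑-W*Δ : ∀ Z → q ∣ ∑ N (λ t → W t * Δ E Z t)
      q∣∑-W*Δ Z = subst (q ∣_) (sym byParts) (∣-∑ n R (λ i i<n → ∣-∑ a _ (λ p p<a → ∣n⇒∣m*n (dZ i p) (q∣W-step i i<n p p<a))))
        where
        open ≡-Reasoning
        dZ dW : ℕ → ℕ → ℤ
        dZ i p = Z (v i (suc p)) - Z (v i p)
        dW i p = W (v i (suc p)) - W (v i p)
        R : ℕ → ℤ
        R i = ∑ a (λ p → dZ i p * (dW i p - α i))
        split : ∀ z w x → z * w ≡ x * z + z * (w - x)
        split = solve-∀
        path : ∀ i → ∑ a (λ p → dZ i p * dW i p) ≡ α i * (Z 1 - Z 0) + R i
        path i = begin
          ∑ a (λ p → dZ i p * dW i p)                          ≡⟨ ∑-cong a (λ p → split (dZ i p) (dW i p) (α i)) ⟩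
          ∑ a (λ p → α i * dZ i p + dZ i p * (dW i p - α i))   ≡⟨ ∑-distrib-+ a (λ p → α i * dZ i p) (λ p → dZ i p * (dW i p - α i)) ⟩
          ∑ a (λ p → α i * dZ i p) + R i                       ≡⟨ cong (_+ R i) (∑-*ˡ a (α i) (dZ i)) ⟩
          α i * ∑ a (dZ i) + R i                               ≡⟨ cong (λ x → α i * x + R i) (∑-telescope a (λ p → Z (v i p))) ⟩
          α i * (Z (v i a) - Z 0) + R i                        ≡⟨ cong (λ y → α i * (Z y - Z 0) + R i) (pathVertex-y m i) ⟩
          α i * (Z 1 - Z 0) + R i                              ∎
        collect : ∀ z y s r → z * (y - + 0) + (s * z + r) ≡ z * (y + s) + r
        collect = solve-∀
        byParts : ∑ N (λ t → W t * Δ E Z t) ≡ ∑ n R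
        byParts = begin
          ∑ N (λ t → W t * Δ E Z t)
            ≡⟨ ∑-*-Δ N E W Z (hingeEdgesBelow m n) ⟩
          ∑ₗ E (λ (b , c) → (Z c - Z b) * (W c - W b))
            ≡⟨ ∑ₗ-hingeEdges m n (λ (b , c) → (Z c - Z b) * (W c - W b)) ⟩
          (Z 1 - Z 0) * (Y - + 0) + ∑ n (λ i → ∑ a (λ p → dZ i p * dW i p))
            ≡⟨ cong (_+_ ((Z 1 - Z 0) * (Y - + 0))) (trans (∑-cong n path) (∑-distrib-+ n (λ i → α i * (Z 1 - Z 0)) R)) ⟩
          (Z 1 - Z 0) * (Y - + 0) + (∑ n (λ i → α i * (Z 1 - Z 0)) + ∑ n R)
            ≡⟨ cong (λ x → (Z 1 - Z 0) * (Y - + 0) + (x + ∑ n R)) (∑-*ʳ n (Z 1 - Z 0) α) ⟩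
          (Z 1 - Z 0) * (Y - + 0) + (∑ n α * (Z 1 - Z 0) + ∑ n R)
            ≡⟨ collect (Z 1 - Z 0) Y (∑ n α) (∑ n R) ⟩
          (Z 1 - Z 0) * (Y + ∑ n α) + ∑ n R
            ≡⟨ cong (λ x → (Z 1 - Z 0) * x + ∑ n R) Y+∑α≡0 ⟩
          (Z 1 - Z 0) * + 0 + ∑ n R
            ≡⟨ trans (cong (_+ ∑ n R) (ℤP.*-zeroʳ (Z 1 - Z 0))) (ℤP.+-identityˡ _) ⟩
          ∑ n R ∎

    P : ℕ → ℕ → ℤ
    P i t = δ (v i 1) t - δ 0 t

    slide : ℕ → ℕ → ℕ → ℤ
    slide i p = onPaths m (+ 0) (+ 0) (λ i′ j → δ i i′ * - + (p ∸ suc j))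

    slide-pathVertex : ∀ i p → p ≤ a → ∀ i′ p′ → p′ ≤ a → slide i p (v i′ p′) ≡ δ i i′ * (+ p * δ 0 p′ - + (p ∸ p′))
    slide-pathVertex i p p≤a i′ zero _ = sym (trans (cong (λ x → δ i i′ * (+ p * x - + p)) (δ-refl 0)) (cancel (δ i i′) (+ p)))
      where
      cancel : ∀ d x → d * (x * + 1 - x) ≡ + 0
      cancel = solve-∀
    slide-pathVertex i p p≤a i′ (suc j) (s≤s j≤m) with ℕP.m≤n⇒m<n∨m≡n j≤m
    ... | inj₁ j<m = trans (onPaths-pathVertex m (+ 0) (+ 0) _ i′ j j<m)
      (sym (trans (cong (λ x → δ i i′ * (+ p * x - + (p ∸ suc j))) (δ-≢ 0 (suc j) λ ()))
                  (simplify (δ i i′) (+ p) (+ (p ∸ suc j)))))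
      where
      simplify : ∀ d x y → d * (x * + 0 - y) ≡ d * - y
      simplify = solve-∀
    ... | inj₂ refl = trans (onPaths-y m (+ 0) (+ 0) _ i′)
      (sym (trans (cong₂ (λ x y → δ i i′ * (+ p * x - + y)) (δ-≢ 0 (suc m) λ ()) (ℕP.m≤n⇒m∸n≡0 p≤a))
                  (simplify (δ i i′) (+ p))))
      where
      simplify : ∀ d x → d * (x * + 0 - + 0) ≡ + 0
      simplify = solve-∀

    Δ-slide : ∀ i p → i < n → p ≤ a → ∀ t → Δ E (slide i p) t ≡ (δ (v i p) t - δ 0 t) - + p * P i t
    Δ-slide i p i<n p≤a t = begin
      Δ E (slide i p) t
        ≡⟨ Δ-hinge (slide i p) φ (λ i′ p′ → slide-pathVertex i p p≤a i′ p′) t ⟩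
      (+ 0 - + 0) * (δ 1 t - δ 0 t) + ∑ n (λ i′ → ∑ a (λ p′ → (φ i′ (suc p′) - φ i′ p′) * stepδ i′ p′ t))
        ≡⟨ trans (ℤP.+-identityˡ _) (∑-cong n (λ i′ → trans (∑-cong a (λ p′ → φ-step i′ p′)) (∑-*ˡ a (δ i i′) (λ p′ → c p′ * stepδ i′ p′ t)))) ⟩
      ∑ n (λ i′ → δ i i′ * ∑ a (λ p′ → c p′ * stepδ i′ p′ t))
        ≡⟨ ∑-δ n (λ i′ → ∑ a (λ p′ → c p′ * stepδ i′ p′ t)) i<n ⟩
      ∑ a (λ p′ → c p′ * stepδ i p′ t)
        ≡⟨ trans (∑-cong a (λ p′ → ℤP.*-distribʳ-+ (stepδ i p′ t) (+ (p ∸ p′) - + (p ∸ suc p′)) (- (+ p * δ 0 p′))))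
                 (∑-distrib-+ a (λ p′ → (+ (p ∸ p′) - + (p ∸ suc p′)) * stepδ i p′ t) (λ p′ → - (+ p * δ 0 p′) * stepδ i p′ t)) ⟩
      ∑ a (λ p′ → (+ (p ∸ p′) - + (p ∸ suc p′)) * stepδ i p′ t) + ∑ a (λ p′ → - (+ p * δ 0 p′) * stepδ i p′ t)
        ≡⟨ cong₂ _+_ (∑-prefix a p (λ q → stepδ i q t) p≤a) atX ⟩
      ∑ p (λ q → stepδ i q t) + - (+ p * P i t)
        ≡⟨ cong (_+ - (+ p * P i t)) (∑-telescope p (λ q → δ (v i q) t)) ⟩
      (δ (v i p) t - δ 0 t) - + p * P i t ∎
      where
      open ≡-Reasoning
      φ : ℕ → ℕ → ℤ
      φ i′ p′ = δ i i′ * (+ p * δ 0 p′ - + (p ∸ p′))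
      c : ℕ → ℤ
      c p′ = (+ (p ∸ p′) - + (p ∸ suc p′)) - + p * δ 0 p′
      regroup : ∀ d x y z e w → (d * (x * + 0 - y) - d * (x * e - z)) * w ≡ d * (((z - y) - x * e) * w)
      regroup = solve-∀
      φ-step : ∀ i′ p′ → (φ i′ (suc p′) - φ i′ p′) * stepδ i′ p′ t ≡ δ i i′ * (c p′ * stepδ i′ p′ t)
      φ-step i′ p′ = trans (cong (λ x → (δ i i′ * (+ p * x - + (p ∸ suc p′)) - φ i′ p′) * stepδ i′ p′ t) (δ-≢ 0 (suc p′) λ ()))
        (regroup (δ i i′) (+ p) (+ (p ∸ suc p′)) (+ (p ∸ p′)) (δ 0 p′) (stepδ i′ p′ t))
      pull : ∀ x e w → - (x * e) * w ≡ - (x * (e * w))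
      pull = solve-∀
      atX : ∑ a (λ p′ → - (+ p * δ 0 p′) * stepδ i p′ t) ≡ - (+ p * P i t)
      atX = begin
        ∑ a (λ p′ → - (+ p * δ 0 p′) * stepδ i p′ t) ≡⟨ ∑-cong a (λ p′ → pull (+ p) (δ 0 p′) (stepδ i p′ t)) ⟩
        ∑ a (λ p′ → - (+ p * (δ 0 p′ * stepδ i p′ t))) ≡⟨ ∑-neg a (λ p′ → + p * (δ 0 p′ * stepδ i p′ t)) ⟩
        - ∑ a (λ p′ → + p * (δ 0 p′ * stepδ i p′ t))   ≡⟨ cong -_ (∑-*ˡ a (+ p) (λ p′ → δ 0 p′ * stepδ i p′ t)) ⟩
        - (+ p * ∑ a (λ p′ → δ 0 p′ * stepδ i p′ t))   ≡⟨ cong (λ x → - (+ p * x)) (∑-δ a (λ q → stepδ i q t) (s≤s z≤n)) ⟩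
        - (+ p * P i t)                                ∎

    fireX : ℕ → ℤ
    fireX = onPaths m (+ 1) (+ 0) (λ _ _ → + 0)

    fireX-pathVertex : ∀ i p → p ≤ a → fireX (v i p) ≡ δ 0 p
    fireX-pathVertex i zero    _ = sym (δ-refl 0)
    fireX-pathVertex i (suc j) (s≤s j≤m) with ℕP.m≤n⇒m<n∨m≡n j≤m
    ... | inj₁ j<m  = trans (onPaths-pathVertex m (+ 1) (+ 0) _ i j j<m) (sym (δ-≢ 0 (suc j) λ ()))
    ... | inj₂ refl = trans (onPaths-y m (+ 1) (+ 0) _ i) (sym (δ-≢ 0 (suc m) λ ()))

    Δ-fireX : ∀ t → Δ E fireX t ≡ - (δ 1 t - δ 0 t) - ∑ n (λ i → P i t)
    Δ-fireX t = begin
      Δ E fireX t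
        ≡⟨ Δ-hinge fireX (λ _ p → δ 0 p) fireX-pathVertex t ⟩
      (+ 0 - + 1) * (δ 1 t - δ 0 t) + ∑ n (λ i → ∑ a (λ p → (δ 0 (suc p) - δ 0 p) * stepδ i p t))
        ≡⟨ cong₂ _+_ (negate (δ 1 t - δ 0 t)) (∑-cong n alongPath) ⟩
      - (δ 1 t - δ 0 t) + ∑ n (λ i → - P i t)
        ≡⟨ cong (_+_ (- (δ 1 t - δ 0 t))) (∑-neg n (λ i → P i t)) ⟩
      - (δ 1 t - δ 0 t) - ∑ n (λ i → P i t) ∎
      where
      open ≡-Reasoning
      negate : ∀ w → (+ 0 - + 1) * w ≡ - w
      negate = solve-∀
      pull : ∀ e w → (+ 0 - e) * w ≡ - (e * w)
      pull = solve-∀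
      alongPath : ∀ i → ∑ a (λ p → (δ 0 (suc p) - δ 0 p) * stepδ i p t) ≡ - P i t
      alongPath i = begin
        ∑ a (λ p → (δ 0 (suc p) - δ 0 p) * stepδ i p t)
          ≡⟨ ∑-cong a (λ p → trans (cong (λ x → (x - δ 0 p) * stepδ i p t) (δ-≢ 0 (suc p) λ ())) (pull (δ 0 p) (stepδ i p t))) ⟩
        ∑ a (λ p → - (δ 0 p * stepδ i p t)) ≡⟨ ∑-neg a (λ p → δ 0 p * stepδ i p t) ⟩
        - ∑ a (λ p → δ 0 p * stepδ i p t)   ≡⟨ cong -_ (∑-δ a (λ q → stepδ i q t) (s≤s z≤n)) ⟩
        - P i t                             ∎

    δ-pathVertex : ∀ i p → i < n → p ≤ a → ∀ t → δ (v i p) t ≡ δ 0 t + + p * P i t + Δ E (slide i p) t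
    δ-pathVertex i p i<n p≤a t =
      trans (rearrange (δ (v i p) t) (δ 0 t) (+ p) (P i t)) (cong (_+_ (δ 0 t + + p * P i t)) (sym (Δ-slide i p i<n p≤a t)))
      where
      rearrange : ∀ d e x y → d ≡ e + x * y + ((d - e) - x * y)
      rearrange = solve-∀

    ∑-vertices : ∀ (G : ℕ → ℤ) → ∑ N G ≡ G 0 + (G 1 + ∑ n (λ i → ∑ m (λ j → G (v i (suc j)))))
    ∑-vertices G = cong (λ x → G 0 + (G 1 + x)) (trans (∑-blocks n m (λ r → G (2 ℕ.+ r)))
      (∑-cong n (λ i → ∑-cong< m (λ j j<m → cong G (sym (pathVertex-internal m i j j<m))))))

    divisor-expansion : ∀ (F : ℕ → ℤ) t → t < N →
      F t ≡ F 0 * δ 0 t + (F 1 * δ 1 t + ∑ n (λ i → ∑ m (λ j → F (v i (suc j)) * δ (v i (suc j)) t)))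
    divisor-expansion F t t<N = trans (sym (∑-δ′ N F t<N)) (trans (∑-vertices (λ s → δ s t * F s))
      (cong₂ _+_ (ℤP.*-comm (δ 0 t) (F 0)) (cong₂ _+_ (ℤP.*-comm (δ 1 t) (F 1))
        (∑-cong n (λ i → ∑-cong m (λ j → ℤP.*-comm (δ (v i (suc j)) t) (F (v i (suc j)))))))))

    moment : (ℕ → ℤ) → ℕ → ℤ
    moment F i = ∑ m (λ j → F (v i (suc j)) * + suc j)

    slideAll : (ℕ → ℤ) → ℕ → ℤ
    slideAll F w = ∑ n (λ i → ∑ m (λ j → F (v i (suc j)) * slide i (suc j) w))

    Δ-slideAll : ∀ F t → Δ E (slideAll F) t ≡ ∑ n (λ i → ∑ m (λ j → F (v i (suc j)) * Δ E (slide i (suc j)) t))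
    Δ-slideAll F t = trans (Δ-∑ E n (λ i w → ∑ m (λ j → F (v i (suc j)) * slide i (suc j) w)) t)
      (∑-cong n (λ i → trans (Δ-∑ E m (λ j w → F (v i (suc j)) * slide i (suc j) w) t)
        (∑-cong m (λ j → Δ-* E (F (v i (suc j))) (slide i (suc j)) t))))

    internal-chips : ∀ F t →
      ∑ n (λ i → ∑ m (λ j → F (v i (suc j)) * δ (v i (suc j)) t))
        ≡ ∑ n (λ i → ∑ m (λ j → F (v i (suc j)))) * δ 0 t + ∑ n (λ i → moment F i * P i t) + Δ E (slideAll F) t
    internal-chips F t = begin
      ∑ n (λ i → ∑ m (λ j → f i j * δ (v i (suc j)) t))
        ≡⟨ ∑-cong< n (λ i i<n → trans (∑-cong< m (λ j j<m → trans
             (cong (_*_ (f i j)) (δ-pathVertex i (suc j) i<n (ℕP.m≤n⇒m≤1+n j<m) t))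
             (expand (f i j) (δ 0 t) (+ suc j) (P i t) (Δ E (slide i (suc j)) t))))
             (∑-distrib-+₃ m (λ j → f i j * δ 0 t) (λ j → f i j * + suc j * P i t) (λ j → f i j * Δ E (slide i (suc j)) t))) ⟩
      ∑ n (λ i → ∑ m (λ j → f i j * δ 0 t) + ∑ m (λ j → f i j * + suc j * P i t) + ∑ m (λ j → f i j * Δ E (slide i (suc j)) t))
        ≡⟨ ∑-distrib-+₃ n _ _ _ ⟩
      ∑ n (λ i → ∑ m (λ j → f i j * δ 0 t)) + ∑ n (λ i → ∑ m (λ j → f i j * + suc j * P i t))
        + ∑ n (λ i → ∑ m (λ j → f i j * Δ E (slide i (suc j)) t))
        ≡⟨ cong₂ _+_ (cong₂ _+_
             (trans (∑-cong n (λ i → ∑-*ʳ m (δ 0 t) (f i))) (∑-*ʳ n (δ 0 t) (λ i → ∑ m (f i))))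
             (∑-cong n (λ i → ∑-*ʳ m (P i t) (λ j → f i j * + suc j))))
           (sym (Δ-slideAll F t)) ⟩
      ∑ n (λ i → ∑ m (f i)) * δ 0 t + ∑ n (λ i → moment F i * P i t) + Δ E (slideAll F) t ∎
      where
      open ≡-Reasoning
      f : ℕ → ℕ → ℤ
      f i j = F (v i (suc j))
      expand : ∀ x d s p l → x * (d + s * p + l) ≡ x * d + x * s * p + x * l
      expand = solve-∀

  module NormalForm (m n₁ : ℕ) .{{_ : NonZero m}} where

    open Hinge m (suc n₁) public

    a+n : ℕ
    a+n = a ℕ.+ suc n₁

    Q : ℕ → ℕ → ℤ
    Q s t = P (suc s) t - P 0 t

    NF : ℕ → (ℕ → ℕ) → ℕ → ℤ
    NF c f t = + c * P 0 t + ∑ n₁ (λ s → + f s * Q s t)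

    Δ-slide-y : ∀ i → i < suc n₁ → ∀ t → Δ E (slide i a) t ≡ (δ 1 t - δ 0 t) - + a * P i t
    Δ-slide-y i i<n t = trans (Δ-slide i a i<n ℕP.≤-refl t) (cong (λ y → (δ y t - δ 0 t) - + a * P i t) (pathVertex-y m i))

    ∑-P : ∀ t → ∑ (suc n₁) (λ i → P i t) ≡ + suc n₁ * P 0 t + ∑ n₁ (λ s → Q s t)
    ∑-P t = begin
      P 0 t + ∑ n₁ (λ s → P (suc s) t)           ≡⟨ cong (_+_ (P 0 t)) (∑-cong n₁ (λ s → split (P (suc s) t) (P 0 t))) ⟩
      P 0 t + ∑ n₁ (λ s → P 0 t + Q s t)         ≡⟨ cong (_+_ (P 0 t)) (∑-distrib-+ n₁ (λ _ → P 0 t) (λ s → Q s t)) ⟩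
      P 0 t + (∑ n₁ (λ _ → P 0 t) + ∑ n₁ (λ s → Q s t))
        ≡⟨ cong (λ x → P 0 t + (x + ∑ n₁ (λ s → Q s t))) (∑-const n₁ (P 0 t)) ⟩
      P 0 t + (+ n₁ * P 0 t + ∑ n₁ (λ s → Q s t)) ≡⟨ regroup (P 0 t) (+ n₁) (∑ n₁ (λ s → Q s t)) ⟩
      (+ 1 + + n₁) * P 0 t + ∑ n₁ (λ s → Q s t)  ≡⟨ cong (λ x → x * P 0 t + ∑ n₁ (λ s → Q s t)) (sym (ℤP.pos-+ 1 n₁)) ⟩
      + suc n₁ * P 0 t + ∑ n₁ (λ s → Q s t)      ∎
      where
      open ≡-Reasoning
      split : ∀ x y → x ≡ y + (x - y)
      split = solve-∀
      regroup : ∀ p k q → p + (k * p + q) ≡ (+ 1 + k) * p + q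
      regroup = solve-∀

    a*Q≡Δ : ∀ s → s < n₁ → ∀ t → + a * Q s t ≡ Δ E (λ w → slide 0 a w - slide (suc s) a w) t
    a*Q≡Δ s s<n₁ t = sym (begin
      Δ E (λ w → slide 0 a w - slide (suc s) a w) t
        ≡⟨ Δ-− E (slide 0 a) (slide (suc s) a) t ⟩
      Δ E (slide 0 a) t - Δ E (slide (suc s) a) t
        ≡⟨ cong₂ _-_ (Δ-slide-y 0 (s≤s z≤n) t) (Δ-slide-y (suc s) (s≤s s<n₁) t) ⟩
      ((δ 1 t - δ 0 t) - + a * P 0 t) - ((δ 1 t - δ 0 t) - + a * P (suc s) t)
        ≡⟨ cancel (δ 1 t - δ 0 t) (+ a) (P 0 t) (P (suc s) t) ⟩
      + a * Q s t ∎)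
      where
      open ≡-Reasoning
      cancel : ∀ d x p q → (d - x * p) - (d - x * q) ≡ x * (q - p)
      cancel = solve-∀

    [a+n]P₀+∑Q≡-Δ : ∀ t → + a+n * P 0 t + ∑ n₁ (λ s → Q s t) ≡ - Δ E (λ w → fireX w + slide 0 a w) t
    [a+n]P₀+∑Q≡-Δ t = sym (begin
      - Δ E (λ w → fireX w + slide 0 a w) t
        ≡⟨ cong -_ (trans (Δ-+ E fireX (slide 0 a) t) (cong₂ _+_ (Δ-fireX t) (Δ-slide-y 0 (s≤s z≤n) t))) ⟩
      - ((- (δ 1 t - δ 0 t) - ∑ (suc n₁) (λ i → P i t)) + ((δ 1 t - δ 0 t) - + a * P 0 t))
        ≡⟨ cancel (δ 1 t - δ 0 t) (∑ (suc n₁) (λ i → P i t)) (+ a) (P 0 t) ⟩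
      ∑ (suc n₁) (λ i → P i t) + + a * P 0 t
        ≡⟨ cong (_+ + a * P 0 t) (∑-P t) ⟩
      + suc n₁ * P 0 t + ∑ n₁ (λ s → Q s t) + + a * P 0 t
        ≡⟨ regroup (+ suc n₁) (P 0 t) (∑ n₁ (λ s → Q s t)) (+ a) ⟩
      (+ a + + suc n₁) * P 0 t + ∑ n₁ (λ s → Q s t)
        ≡⟨ cong (λ x → x * P 0 t + ∑ n₁ (λ s → Q s t)) (sym (ℤP.pos-+ a (suc n₁))) ⟩
      + a+n * P 0 t + ∑ n₁ (λ s → Q s t) ∎)
      where
      open ≡-Reasoning
      cancel : ∀ d s x p → - ((- d - s) + (d - x * p)) ≡ s + x * p
      cancel = solve-∀
      regroup : ∀ k p q x → k * p + q + x * p ≡ (x + k) * p + q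
      regroup = solve-∀

    chipsToP₀ : ∀ F → ∑ N F ≡ + 0 → ∀ t → t < N →
      F t ≡ (F 1 * + a + ∑ (suc n₁) (moment F)) * P 0 t + ∑ n₁ (λ s → moment F (suc s) * Q s t)
            + Δ E (λ w → F 1 * slide 0 a w + slideAll F w) t
    chipsToP₀ F ∑F≡0 t t<N = begin
      F t
        ≡⟨ divisor-expansion F t t<N ⟩
      F 0 * δ 0 t + (F 1 * δ 1 t + ∑ (suc n₁) (λ i → ∑ m (λ j → F (v i (suc j)) * δ (v i (suc j)) t)))
        ≡⟨ cong₂ (λ x y → F 0 * δ 0 t + (F 1 * x + y)) δy (internal-chips F t) ⟩
      F 0 * δ 0 t + (F 1 * (δ 0 t + + a * P 0 t + Δ E (slide 0 a) t) + (S * δ 0 t + MP + Δ E (slideAll F) t))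
        ≡⟨ regroup (F 0) (F 1) (δ 0 t) (+ a) (P 0 t) (Δ E (slide 0 a) t) S MP (Δ E (slideAll F) t) ⟩
      (F 0 + (F 1 + S)) * δ 0 t + (F 1 * + a * P 0 t + MP + (F 1 * Δ E (slide 0 a) t + Δ E (slideAll F) t))
        ≡⟨ cong₂ (λ x y → x * δ 0 t + (F 1 * + a * P 0 t + MP + y)) (trans (sym (∑-vertices F)) ∑F≡0) (sym Δ-Z) ⟩
      + 0 * δ 0 t + (F 1 * + a * P 0 t + MP + Δ E Z t)
        ≡⟨ cong (λ x → + 0 * δ 0 t + (F 1 * + a * P 0 t + x + Δ E Z t)) (∑-rebase n₁ (moment F) (λ i → P i t)) ⟩
      + 0 * δ 0 t + (F 1 * + a * P 0 t + (∑ (suc n₁) (moment F) * P 0 t + R) + Δ E Z t)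
        ≡⟨ collect (δ 0 t) (F 1) (+ a) (P 0 t) (∑ (suc n₁) (moment F)) R (Δ E Z t) ⟩
      (F 1 * + a + ∑ (suc n₁) (moment F)) * P 0 t + R + Δ E Z t ∎
      where
      open ≡-Reasoning
      S MP R : ℤ
      S  = ∑ (suc n₁) (λ i → ∑ m (λ j → F (v i (suc j))))
      MP = ∑ (suc n₁) (λ i → moment F i * P i t)
      R  = ∑ n₁ (λ s → moment F (suc s) * Q s t)
      Z : ℕ → ℤ
      Z w = F 1 * slide 0 a w + slideAll F w
      δy : δ 1 t ≡ δ 0 t + + a * P 0 t + Δ E (slide 0 a) t
      δy = trans (cong (λ y → δ y t) (sym (pathVertex-y m 0))) (δ-pathVertex 0 a (s≤s z≤n) ℕP.≤-refl t)
      Δ-Z : Δ E Z t ≡ F 1 * Δ E (slide 0 a) t + Δ E (slideAll F) t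
      Δ-Z = trans (Δ-+ E (λ w → F 1 * slide 0 a w) (slideAll F) t) (cong (_+ Δ E (slideAll F) t) (Δ-* E (F 1) (slide 0 a) t))
      regroup : ∀ f₀ f₁ d x p l s mp l′ →
        f₀ * d + (f₁ * (d + x * p + l) + (s * d + mp + l′)) ≡ (f₀ + (f₁ + s)) * d + (f₁ * x * p + mp + (f₁ * l + l′))
      regroup = solve-∀
      collect : ∀ d f₁ x p m r z → + 0 * d + (f₁ * x * p + (m * p + r) + z) ≡ (f₁ * x + m) * p + r + z
      collect = solve-∀

    module ReduceCoefficients (g : ℤ) (w : ℕ → ℤ) where

      μ : ℤ
      μ = g /ℕ a+n

      c : ℕ
      c = g %ℕ a+n

      λ′ : ℕ → ℤ
      λ′ s = (w s - μ) /ℕ a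

      f : ℕ → ℕ
      f s = (w s - μ) %ℕ a

      c< : c < a+n
      c< = n%ℕd<d g a+n

      f< : ∀ s → f s < a
      f< s = n%ℕd<d (w s - μ) a

      Z : ℕ → ℤ
      Z u = ∑ n₁ (λ s → λ′ s * (slide 0 a u - slide (suc s) a u)) - μ * (fireX u + slide 0 a u)

      Δ-Z : ∀ t → Δ E Z t ≡ ∑ n₁ (λ s → λ′ s * (+ a * Q s t)) + μ * (+ a+n * P 0 t + ∑ n₁ (λ s → Q s t))
      Δ-Z t = begin
        Δ E Z t
          ≡⟨ Δ-− E (λ u → ∑ n₁ (λ s → λ′ s * (slide 0 a u - slide (suc s) a u))) (λ u → μ * (fireX u + slide 0 a u)) t ⟩
        Δ E (λ u → ∑ n₁ (λ s → λ′ s * (slide 0 a u - slide (suc s) a u))) t - Δ E (λ u → μ * (fireX u + slide 0 a u)) t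
          ≡⟨ cong₂ _-_ (trans (Δ-∑ E n₁ (λ s u → λ′ s * (slide 0 a u - slide (suc s) a u)) t)
                               (∑-cong< n₁ (λ s s<n₁ → trans (Δ-* E (λ′ s) (λ u → slide 0 a u - slide (suc s) a u) t)
                                                               (cong (_*_ (λ′ s)) (sym (a*Q≡Δ s s<n₁ t))))))
                       (Δ-* E μ (λ u → fireX u + slide 0 a u) t) ⟩
        ∑ n₁ (λ s → λ′ s * (+ a * Q s t)) - μ * Δ E (λ u → fireX u + slide 0 a u) t
          ≡⟨ negate (∑ n₁ (λ s → λ′ s * (+ a * Q s t))) μ (Δ E (λ u → fireX u + slide 0 a u) t) ⟩
        ∑ n₁ (λ s → λ′ s * (+ a * Q s t)) + μ * - Δ E (λ u → fireX u + slide 0 a u) t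
          ≡⟨ cong (λ x → ∑ n₁ (λ s → λ′ s * (+ a * Q s t)) + μ * x) (sym ([a+n]P₀+∑Q≡-Δ t)) ⟩
        ∑ n₁ (λ s → λ′ s * (+ a * Q s t)) + μ * (+ a+n * P 0 t + ∑ n₁ (λ s → Q s t)) ∎
        where
        open ≡-Reasoning
        negate : ∀ x y z → x - y * z ≡ x + y * - z
        negate = solve-∀

      reduce : ∀ t → g * P 0 t + ∑ n₁ (λ s → w s * Q s t) ≡ NF c f t + Δ E Z t
      reduce t = sym (begin
        NF c f t + Δ E Z t
          ≡⟨ cong (_+_ (NF c f t)) (Δ-Z t) ⟩
        + c * P 0 t + ∑ n₁ (λ s → + f s * Q s t) + (∑ n₁ (λ s → λ′ s * (+ a * Q s t)) + μ * (+ a+n * P 0 t + ∑ n₁ (λ s → Q s t)))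
          ≡⟨ regroup (+ c) (P 0 t) (∑ n₁ (λ s → + f s * Q s t)) (∑ n₁ (λ s → λ′ s * (+ a * Q s t))) μ (+ a+n) (∑ n₁ (λ s → Q s t)) ⟩
        (+ c + μ * + a+n) * P 0 t + (∑ n₁ (λ s → + f s * Q s t) + ∑ n₁ (λ s → λ′ s * (+ a * Q s t)) + μ * ∑ n₁ (λ s → Q s t))
          ≡⟨ cong₂ (λ x y → x * P 0 t + y) (sym (a≡a%ℕn+[a/ℕn]*n g a+n)) (sym combine-sums) ⟩
        g * P 0 t + ∑ n₁ (λ s → + f s * Q s t + λ′ s * (+ a * Q s t) + μ * Q s t)
          ≡⟨ cong (_+_ (g * P 0 t)) (∑-cong n₁ perTerm) ⟩
        g * P 0 t + ∑ n₁ (λ s → w s * Q s t) ∎)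
        where
        open ≡-Reasoning
        regroup : ∀ c p sf sl u k sq → c * p + sf + (sl + u * (k * p + sq)) ≡ (c + u * k) * p + (sf + sl + u * sq)
        regroup = solve-∀
        combine-sums : ∑ n₁ (λ s → + f s * Q s t + λ′ s * (+ a * Q s t) + μ * Q s t)
                     ≡ ∑ n₁ (λ s → + f s * Q s t) + ∑ n₁ (λ s → λ′ s * (+ a * Q s t)) + μ * ∑ n₁ (λ s → Q s t)
        combine-sums = trans (∑-distrib-+₃ n₁ (λ s → + f s * Q s t) (λ s → λ′ s * (+ a * Q s t)) (λ s → μ * Q s t))
          (cong (_+_ (∑ n₁ (λ s → + f s * Q s t) + ∑ n₁ (λ s → λ′ s * (+ a * Q s t)))) (∑-*ˡ n₁ μ (λ s → Q s t)))
        factor : ∀ f l x u q → f * q + l * (x * q) + u * q ≡ (f + l * x + u) * q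
        factor = solve-∀
        w≡ : ∀ s → + f s + λ′ s * + a + μ ≡ w s
        w≡ s = trans (cong (_+ μ) (sym (a≡a%ℕn+[a/ℕn]*n (w s - μ) a))) (shift (w s) μ)
          where
          shift : ∀ x y → x - y + y ≡ x
          shift = solve-∀
        perTerm : ∀ s → + f s * Q s t + λ′ s * (+ a * Q s t) + μ * Q s t ≡ w s * Q s t
        perTerm s = trans (factor (+ f s) (λ′ s) (+ a) μ (Q s t)) (cong (_* Q s t) (w≡ s))

    NF-cong : ∀ {c c′ f f′} → c ≡ c′ → (∀ s → s < n₁ → f s ≡ f′ s) → ∀ t → NF c f t ≡ NF c′ f′ t
    NF-cong c≡c′ f≡f′ t = cong₂ (λ x y → + x * P 0 t + y) c≡c′ (∑-cong< n₁ (λ s s<n₁ → cong (λ x → + x * Q s t) (f≡f′ s s<n₁)))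

    module Reduction (F : ℕ → ℤ) where

      open ReduceCoefficients (F 1 * + a + ∑ (suc n₁) (moment F)) (λ s → moment F (suc s)) public

      firing : ℕ → ℤ
      firing u = (F 1 * slide 0 a u + slideAll F u) + Z u

      F-NF≡Δ : ∑ N F ≡ + 0 → ∀ t → t < N → F t - NF c f t ≡ Δ E firing t
      F-NF≡Δ ∑F≡0 t t<N = begin
        F t - NF c f t
          ≡⟨ cong (_- NF c f t) (trans (chipsToP₀ F ∑F≡0 t t<N) (cong (_+ Δ E Z₀ t) (reduce t))) ⟩
        NF c f t + Δ E Z t + Δ E Z₀ t - NF c f t ≡⟨ cancel (NF c f t) (Δ E Z t) (Δ E Z₀ t) ⟩
        Δ E Z₀ t + Δ E Z t                       ≡⟨ sym (Δ-+ E Z₀ Z t) ⟩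
        Δ E firing t                             ∎
        where
        open ≡-Reasoning
        Z₀ : ℕ → ℤ
        Z₀ u = F 1 * slide 0 a u + slideAll F u
        cancel : ∀ x y z → x + y + z - x ≡ z + y
        cancel = solve-∀

    slope : (ℕ → ℤ) → ℕ → ℤ
    slope W i = W (v i 1) - W 0

    ∑-W*P : ∀ W i → i < suc n₁ → ∑ N (λ t → W t * P i t) ≡ slope W i
    ∑-W*P W i i<n = begin
      ∑ N (λ t → W t * (δ (v i 1) t - δ 0 t))         ≡⟨ ∑-cong N (λ t → distrib (W t) (δ (v i 1) t) (δ 0 t)) ⟩
      ∑ N (λ t → δ (v i 1) t * W t - δ 0 t * W t)     ≡⟨ ∑-distrib-− N (λ t → δ (v i 1) t * W t) (λ t → δ 0 t * W t) ⟩
      ∑ N (λ t → δ (v i 1) t * W t) - ∑ N (λ t → δ 0 t * W t)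
        ≡⟨ cong₂ _-_ (∑-δ N W (pathVertex< m (suc n₁) i 1 i<n)) (∑-δ N W (s≤s z≤n)) ⟩
      W (v i 1) - W 0                                  ∎
      where
      open ≡-Reasoning
      distrib : ∀ w x y → w * (x - y) ≡ x * w - y * w
      distrib = solve-∀

    ∑-W*Q : ∀ W s → s < n₁ → ∑ N (λ t → W t * Q s t) ≡ slope W (suc s) - slope W 0
    ∑-W*Q W s s<n₁ = trans (∑-cong N (λ t → distrib (W t) (P (suc s) t) (P 0 t)))
      (trans (∑-distrib-− N (λ t → W t * P (suc s) t) (λ t → W t * P 0 t))
             (cong₂ _-_ (∑-W*P W (suc s) (s≤s s<n₁)) (∑-W*P W 0 (s≤s z≤n))))
      where
      distrib : ∀ w x y → w * (x - y) ≡ w * x - w * y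
      distrib = solve-∀

    ∑-W*NF : ∀ W c f → ∑ N (λ t → W t * NF c f t) ≡ + c * slope W 0 + ∑ n₁ (λ s → + f s * (slope W (suc s) - slope W 0))
    ∑-W*NF W c f = begin
      ∑ N (λ t → W t * (+ c * P 0 t + ∑ n₁ (λ s → + f s * Q s t)))
        ≡⟨ trans (∑-cong N (λ t → trans (distrib (W t) (+ c) (P 0 t) (∑ n₁ (λ s → + f s * Q s t)))
                   (cong (_+_ (+ c * (W t * P 0 t))) (trans (sym (∑-*ˡ n₁ (W t) (λ s → + f s * Q s t)))
                     (∑-cong n₁ (λ s → swap (W t) (+ f s) (Q s t)))))))
                 (∑-distrib-+ N (λ t → + c * (W t * P 0 t)) (λ t → ∑ n₁ (λ s → + f s * (W t * Q s t)))) ⟩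
      ∑ N (λ t → + c * (W t * P 0 t)) + ∑ N (λ t → ∑ n₁ (λ s → + f s * (W t * Q s t)))
        ≡⟨ cong₂ _+_ (trans (∑-*ˡ N (+ c) (λ t → W t * P 0 t)) (cong (_*_ (+ c)) (∑-W*P W 0 (s≤s z≤n))))
                     (∑-comm N n₁ (λ t s → + f s * (W t * Q s t))) ⟩
      + c * slope W 0 + ∑ n₁ (λ s → ∑ N (λ t → + f s * (W t * Q s t)))
        ≡⟨ cong (_+_ (+ c * slope W 0)) (∑-cong< n₁ (λ s s<n₁ →
             trans (∑-*ˡ N (+ f s) (λ t → W t * Q s t)) (cong (_*_ (+ f s)) (∑-W*Q W s s<n₁)))) ⟩
      + c * slope W 0 + ∑ n₁ (λ s → + f s * (slope W (suc s) - slope W 0)) ∎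
      where
      open ≡-Reasoning
      distrib : ∀ w c p s → w * (c * p + s) ≡ c * (w * p) + w * s
      distrib = solve-∀
      swap : ∀ w f q → w * (f * q) ≡ f * (w * q)
      swap = solve-∀

    ∑-NF : ∀ c f → ∑ N (NF c f) ≡ + 0
    ∑-NF c f = begin
      ∑ N (NF c f)                                                   ≡⟨ ∑-cong N (λ t → sym (ℤP.*-identityˡ (NF c f t))) ⟩
      ∑ N (λ t → + 1 * NF c f t)                                     ≡⟨ ∑-W*NF (λ _ → + 1) c f ⟩
      + c * + 0 + ∑ n₁ (λ s → + f s * (+ 0 - + 0))                   ≡⟨ cong₂ _+_ (ℤP.*-zeroʳ (+ c))
                                                                          (trans (∑-cong n₁ (λ s → ℤP.*-zeroʳ (+ f s))) (∑-zero n₁)) ⟩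
      + 0                                                            ∎
      where open ≡-Reasoning

  module Uniqueness (m n′ : ℕ) .{{_ : NonZero m}} where

    open NormalForm m (suc n′) public

    slope-onPaths : ∀ Y (α : ℕ → ℤ) i → slope (onPaths m (+ 0) Y (λ i j → α i * + suc j)) i ≡ α i
    slope-onPaths Y α i = trans (cong (_- + 0) (onPaths-pathVertex m (+ 0) Y _ i 0 (ℕ.>-nonZero⁻¹ m))) (simplify (α i))
      where
      simplify : ∀ x → x * + 1 - + 0 ≡ x
      simplify = solve-∀

    ∑-W*Δ≡difference : ∀ (W : ℕ → ℤ) {c c′ : ℕ} {f f′ : ℕ → ℕ} (Z : ℕ → ℤ) → (∀ t → t < N → NF c f t - NF c′ f′ t ≡ Δ E Z t) →
      ∑ N (λ t → W t * Δ E Z t) ≡ ∑ N (λ t → W t * NF c f t) - ∑ N (λ t → W t * NF c′ f′ t)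
    ∑-W*Δ≡difference W {c} {c′} {f} {f′} Z NF-NF≡Δ = begin
      ∑ N (λ t → W t * Δ E Z t)                          ≡⟨ ∑-cong< N (λ t t<N → cong (_*_ (W t)) (sym (NF-NF≡Δ t t<N))) ⟩
      ∑ N (λ t → W t * (NF c f t - NF c′ f′ t))          ≡⟨ ∑-cong N (λ t → distrib (W t) (NF c f t) (NF c′ f′ t)) ⟩
      ∑ N (λ t → W t * NF c f t - W t * NF c′ f′ t)      ≡⟨ ∑-distrib-− N (λ t → W t * NF c f t) (λ t → W t * NF c′ f′ t) ⟩
      ∑ N (λ t → W t * NF c f t) - ∑ N (λ t → W t * NF c′ f′ t) ∎
      where
      open ≡-Reasoning
      distrib : ∀ w x y → w * (x - y) ≡ w * x - w * y
      distrib = solve-∀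

    α₀ : ℕ → ℤ
    α₀ zero          = + 1
    α₀ (suc zero)    = + 1 - + a+n
    α₀ (suc (suc _)) = + 1

    q∣a-α₀a : ∀ i → i < suc (suc n′) → + a * + a+n ∣ + a - α₀ i * + a
    q∣a-α₀a zero          _ = divides (+ 0) (vanish (+ a) (+ a+n))
      where
      vanish : ∀ x y → x - + 1 * x ≡ + 0 * (x * y)
      vanish = solve-∀
    q∣a-α₀a (suc zero)    _ = divides (+ 1) (rewrite′ (+ a) (+ a+n))
      where
      rewrite′ : ∀ x y → x - (+ 1 - y) * x ≡ + 1 * (x * y)
      rewrite′ = solve-∀
    q∣a-α₀a (suc (suc i)) _ = divides (+ 0) (vanish (+ a) (+ a+n))
      where
      vanish : ∀ x y → x - + 1 * x ≡ + 0 * (x * y)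
      vanish = solve-∀

    a+∑α₀≡0 : + a + ∑ (suc (suc n′)) α₀ ≡ + 0
    a+∑α₀≡0 = begin
      + a + (+ 1 + ((+ 1 - + a+n) + ∑ n′ (λ _ → + 1)))
        ≡⟨ cong₂ (λ x y → + a + (+ 1 + ((+ 1 - x) + y))) a+n≡ (trans (∑-const n′ (+ 1)) (ℤP.*-identityʳ (+ n′))) ⟩
      + a + (+ 1 + ((+ 1 - (+ a + (+ 1 + (+ 1 + + n′)))) + + n′))
        ≡⟨ cancel (+ a) (+ n′) ⟩
      + 0 ∎
      where
      open ≡-Reasoning
      a+n≡ : + a+n ≡ + a + (+ 1 + (+ 1 + + n′))
      a+n≡ = trans (ℤP.pos-+ a (suc (suc n′))) (cong (_+_ (+ a)) (trans (ℤP.pos-+ 1 (suc n′)) (cong (_+_ (+ 1)) (ℤP.pos-+ 1 n′))))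
      cancel : ∀ x k → x + (+ 1 + ((+ 1 - (x + (+ 1 + (+ 1 + k)))) + k)) ≡ + 0
      cancel = solve-∀

    module I₀ = Invariant (+ a) (+ a * + a+n) α₀ q∣a-α₀a a+∑α₀≡0

    ∑-W₀*NF : ∀ c f → ∑ N (λ t → I₀.W t * NF c f t) ≡ + c - + a+n * + f 0
    ∑-W₀*NF c f = begin
      ∑ N (λ t → I₀.W t * NF c f t)
        ≡⟨ ∑-W*NF I₀.W c f ⟩
      + c * slope I₀.W 0 + (+ f 0 * (slope I₀.W 1 - slope I₀.W 0) + ∑ n′ (λ s → + f (suc s) * (slope I₀.W (suc (suc s)) - slope I₀.W 0)))
        ≡⟨ cong₂ _+_ (cong (_*_ (+ c)) (sl 0)) (cong₂ _+_ (cong (_*_ (+ f 0)) (cong₂ _-_ (sl 1) (sl 0)))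
             (trans (∑-cong n′ (λ s → trans (cong (_*_ (+ f (suc s))) (cong₂ _-_ (sl (suc (suc s))) (sl 0))) (vanish (+ f (suc s)))))
                    (∑-zero n′))) ⟩
      + c * + 1 + (+ f 0 * ((+ 1 - + a+n) - + 1) + + 0)
        ≡⟨ simplify (+ c) (+ f 0) (+ a+n) ⟩
      + c - + a+n * + f 0 ∎
      where
      open ≡-Reasoning
      sl : ∀ i → slope I₀.W i ≡ α₀ i
      sl = slope-onPaths (+ a) α₀
      vanish : ∀ x → x * (+ 1 - + 1) ≡ + 0
      vanish = solve-∀
      simplify : ∀ c f y → c * + 1 + (f * ((+ 1 - y) - + 1) + + 0) ≡ c - y * f
      simplify = solve-∀

    αₛ : ℕ → ℕ → ℤ
    αₛ s₀ zero          = + 0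
    αₛ s₀ (suc zero)    = - + 1
    αₛ s₀ (suc (suc s)) = δ s₀ s

    a∣-αₛa : ∀ s₀ i → i < suc (suc n′) → + a ∣ + 0 - αₛ s₀ i * + a
    a∣-αₛa s₀ i _ = divides (- αₛ s₀ i) (negate (αₛ s₀ i) (+ a))
      where
      negate : ∀ x y → + 0 - x * y ≡ (- x) * y
      negate = solve-∀

    ∑αₛ≡0 : ∀ {s₀} → s₀ < n′ → + 0 + ∑ (suc (suc n′)) (αₛ s₀) ≡ + 0
    ∑αₛ≡0 s₀<n′ = cong (λ x → + 0 + (+ 0 + (- + 1 + x))) (∑-δ-one n′ s₀<n′)

    module Iₛ {s₀} (s₀<n′ : s₀ < n′) = Invariant (+ 0) (+ a) (αₛ s₀) (a∣-αₛa s₀) (∑αₛ≡0 s₀<n′)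

    ∑-Wₛ*NF : ∀ {s₀} (s₀<n′ : s₀ < n′) c f → ∑ N (λ t → Iₛ.W s₀<n′ t * NF c f t) ≡ + f (suc s₀) - + f 0
    ∑-Wₛ*NF {s₀} s₀<n′ c f = begin
      ∑ N (λ t → W t * NF c f t)
        ≡⟨ ∑-W*NF W c f ⟩
      + c * slope W 0 + (+ f 0 * (slope W 1 - slope W 0) + ∑ n′ (λ s → + f (suc s) * (slope W (suc (suc s)) - slope W 0)))
        ≡⟨ cong₂ _+_ (cong (_*_ (+ c)) (sl 0)) (cong₂ _+_ (cong (_*_ (+ f 0)) (cong₂ _-_ (sl 1) (sl 0)))
             (trans (∑-cong n′ (λ s → trans (cong (_*_ (+ f (suc s))) (cong₂ _-_ (sl (suc (suc s))) (sl 0))) (swap (+ f (suc s)) (δ s₀ s))))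
                    (∑-δ n′ (λ s → + f (suc s)) s₀<n′))) ⟩
      + c * + 0 + (+ f 0 * (- + 1 - + 0) + + f (suc s₀))
        ≡⟨ simplify (+ c) (+ f 0) (+ f (suc s₀)) ⟩
      + f (suc s₀) - + f 0 ∎
      where
      open ≡-Reasoning
      W : ℕ → ℤ
      W = Iₛ.W s₀<n′
      sl : ∀ i → slope W i ≡ αₛ s₀ i
      sl = slope-onPaths (+ 0) (αₛ s₀)
      swap : ∀ x d → x * (d - + 0) ≡ d * x
      swap = solve-∀
      simplify : ∀ c f g → c * + 0 + (f * (- + 1 - + 0) + g) ≡ g - f
      simplify = solve-∀

    NF-injective : ∀ {c c′ f f′} → c < a+n → c′ < a+n →
      (∀ s → s < suc n′ → f s < a) → (∀ s → s < suc n′ → f′ s < a) →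
      ∀ Z → (∀ t → t < N → NF c f t - NF c′ f′ t ≡ Δ E Z t) → c ≡ c′ × (∀ s → s < suc n′ → f s ≡ f′ s)
    NF-injective {c} {c′} {f} {f′} c< c′< f< f′< Z NF-NF≡Δ = c≡c′ , f≡f′
      where
      χ₀ : + a * + a+n ∣ (+ c - + a+n * + f 0) - (+ c′ - + a+n * + f′ 0)
      χ₀ = subst (_ ∣_) (trans (∑-W*Δ≡difference I₀.W {c} {c′} {f} {f′} Z NF-NF≡Δ) (cong₂ _-_ (∑-W₀*NF c f) (∑-W₀*NF c′ f′))) (I₀.q∣∑-W*Δ Z)
      c≡c′ : c ≡ c′
      c≡c′ = ∣-diff-<⇒≡ c< c′< (subst (+ a+n ∣_) (cancel (+ c) (+ c′) (+ f 0) (+ f′ 0) (+ a+n))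
        (∣m∣n⇒∣m+n (∣-trans (divides (+ a) refl) χ₀) (divides (+ f 0 - + f′ 0) (ℤP.*-comm (+ a+n) _))))
        where
        cancel : ∀ c c′ f f′ y → (c - y * f) - (c′ - y * f′) + y * (f - f′) ≡ c - c′
        cancel = solve-∀
      f₀≡f′₀ : f′ 0 ≡ f 0
      f₀≡f′₀ = ∣-diff-<⇒≡ (f′< 0 (s≤s z≤n)) (f< 0 (s≤s z≤n)) (*-cancelʳ-∣ (+ a+n)
        (subst (+ a * + a+n ∣_) (trans (cong (λ x → (+ c - + a+n * + f 0) - (+ x - + a+n * + f′ 0)) (sym c≡c′))
                                         (cancel (+ c) (+ f 0) (+ f′ 0) (+ a+n))) χ₀))
        where
        cancel : ∀ c f f′ y → (c - y * f) - (c - y * f′) ≡ (f′ - f) * y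
        cancel = solve-∀
      f≡f′ : ∀ s → s < suc n′ → f s ≡ f′ s
      f≡f′ zero    _         = sym f₀≡f′₀
      f≡f′ (suc s) (s≤s s<n′) = ∣-diff-<⇒≡ (f< (suc s) (s≤s s<n′)) (f′< (suc s) (s≤s s<n′))
        (subst (+ a ∣_) (trans (cong (λ x → (+ f (suc s) - + f 0) - (+ f′ (suc s) - + x)) f₀≡f′₀)
                                (cancel (+ f (suc s)) (+ f 0) (+ f′ (suc s))))
          (subst (+ a ∣_) (trans (∑-W*Δ≡difference (Iₛ.W s<n′) {c} {c′} {f} {f′} Z NF-NF≡Δ) (cong₂ _-_ (∑-Wₛ*NF s<n′ c f) (∑-Wₛ*NF s<n′ c′ f′)))
                 (Iₛ.q∣∑-W*Δ s<n′ Z)))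
        where
        cancel : ∀ x y z → (x - y) - (z - y) ≡ x - z
        cancel = solve-∀

  extend : ∀ {N} {A : Set} → A → (Fin N → A) → ℕ → A
  extend {N} d g t with t ℕ.<? N
  ... | yes t<N = g (fromℕ< t<N)
  ... | no  _   = d

  extend-toℕ : ∀ {N} {A : Set} (d : A) (g : Fin N → A) u → extend d g (toℕ u) ≡ g u
  extend-toℕ {N} d g u with toℕ u ℕ.<? N
  ... | yes u<N = cong g (fromℕ<-toℕ u u<N)
  ... | no  u≮N = ⊥-elim (u≮N (toℕ<n u))

  extend-< : ∀ {N} {A : Set} (d : A) (g : Fin N → A) {t} (t<N : t < N) → extend d g t ≡ g (fromℕ< t<N)
  extend-< d g t<N = subst (λ t → extend d g t ≡ g (fromℕ< t<N)) (toℕ-fromℕ< t<N) (extend-toℕ d g (fromℕ< t<N))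

  funToFin-cong : ∀ {m n} {g h : Fin m → Fin n} → (∀ x → g x ≡ h x) → funToFin g ≡ funToFin h
  funToFin-cong {zero}  g≗h = refl
  funToFin-cong {suc m} g≗h = cong₂ combine (g≗h fzero) (funToFin-cong (g≗h ∘ fsuc))

  module Digits (a b d : ℕ) where

    residue : Fin (a ^ d ℕ.* a ℕ.* b) → ℕ
    residue i = toℕ (proj₂ (remQuot {a ^ d ℕ.* a} b i))

    digit : Fin (a ^ d ℕ.* a ℕ.* b) → ℕ → ℕ
    digit i zero    = toℕ (proj₂ (remQuot {a ^ d} a (proj₁ (remQuot {a ^ d ℕ.* a} b i))))
    digit i (suc s) = extend 0 (toℕ ∘ finToFun {a} {d} (proj₁ (remQuot {a ^ d} a (proj₁ (remQuot {a ^ d ℕ.* a} b i))))) s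

    residue< : ∀ i → residue i < b
    residue< i = toℕ<n _

    digit< : ∀ i s → s < suc d → digit i s < a
    digit< i zero    _          = toℕ<n _
    digit< i (suc s) (s≤s s<d) = subst (_< a) (sym (extend-< 0 _ s<d)) (toℕ<n _)

    digits-injective : ∀ i j → residue i ≡ residue j → (∀ s → s < suc d → digit i s ≡ digit j s) → i ≡ j
    digits-injective i j c≡ f≡ = begin
      i                                              ≡⟨ sym (combine-remQuot {a ^ d ℕ.* a} b i) ⟩
      combine qᵢ (proj₂ (remQuot {a ^ d ℕ.* a} b i)) ≡⟨ cong₂ combine q≡ (toℕ-injective c≡) ⟩
      combine qⱼ (proj₂ (remQuot {a ^ d ℕ.* a} b j)) ≡⟨ combine-remQuot {a ^ d ℕ.* a} b j ⟩
      j                                              ∎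
      where
      open ≡-Reasoning
      qᵢ qⱼ : Fin (a ^ d ℕ.* a)
      qᵢ = proj₁ (remQuot {a ^ d ℕ.* a} b i)
      qⱼ = proj₁ (remQuot {a ^ d ℕ.* a} b j)
      rᵢ rⱼ : Fin (a ^ d)
      rᵢ = proj₁ (remQuot {a ^ d} a qᵢ)
      rⱼ = proj₁ (remQuot {a ^ d} a qⱼ)
      r≗ : ∀ x → finToFun {a} {d} rᵢ x ≡ finToFun rⱼ x
      r≗ x = toℕ-injective (begin
        toℕ (finToFun rᵢ x)               ≡⟨ sym (extend-toℕ 0 (toℕ ∘ finToFun {a} {d} rᵢ) x) ⟩
        digit i (suc (toℕ x))             ≡⟨ f≡ (suc (toℕ x)) (s≤s (toℕ<n x)) ⟩
        digit j (suc (toℕ x))             ≡⟨ extend-toℕ 0 (toℕ ∘ finToFun {a} {d} rⱼ) x ⟩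
        toℕ (finToFun rⱼ x)               ∎)
      r≡ : rᵢ ≡ rⱼ
      r≡ = trans (sym (funToFin-finToFin {d} {a} rᵢ)) (trans (funToFin-cong r≗) (funToFin-finToFin {d} {a} rⱼ))
      q≡ : qᵢ ≡ qⱼ
      q≡ = begin
        qᵢ                                              ≡⟨ sym (combine-remQuot {a ^ d} a qᵢ) ⟩
        combine rᵢ (proj₂ (remQuot {a ^ d} a qᵢ))       ≡⟨ cong₂ combine r≡ (toℕ-injective (f≡ 0 (s≤s z≤n))) ⟩
        combine rⱼ (proj₂ (remQuot {a ^ d} a qⱼ))       ≡⟨ combine-remQuot {a ^ d} a qⱼ ⟩
        qⱼ                                              ∎

    digits-surjective : ∀ {c f} → c < b → (∀ s → s < suc d → f s < a) →
      ∃ λ i → residue i ≡ c × (∀ s → s < suc d → digit i s ≡ f s)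
    digits-surjective {c} {f} c<b f<a = i , c≡ , f≡
      where
      g : Fin d → Fin a
      g x = fromℕ< (f<a (suc (toℕ x)) (s≤s (toℕ<n x)))
      f₀ : Fin a
      f₀ = fromℕ< (f<a 0 (s≤s z≤n))
      i : Fin (a ^ d ℕ.* a ℕ.* b)
      i = combine (combine (funToFin g) f₀) (fromℕ< c<b)
      rq≡ : remQuot {a ^ d ℕ.* a} b i ≡ (combine (funToFin g) f₀ , fromℕ< c<b)
      rq≡ = remQuot-combine (combine (funToFin g) f₀) (fromℕ< c<b)
      rq′≡ : remQuot {a ^ d} a (combine (funToFin g) f₀) ≡ (funToFin g , f₀)
      rq′≡ = remQuot-combine (funToFin g) f₀
      c≡ : residue i ≡ c
      c≡ = trans (cong (toℕ ∘ proj₂) rq≡) (toℕ-fromℕ< c<b)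
      f≡ : ∀ s → s < suc d → digit i s ≡ f s
      f≡ zero    _          = trans (cong (λ rq → toℕ (proj₂ (remQuot {a ^ d} a (proj₁ rq)))) rq≡)
                                    (trans (cong (toℕ ∘ proj₂) rq′≡) (toℕ-fromℕ< _))
      f≡ (suc s) (s≤s s<d) = begin
        digit i (suc s)
          ≡⟨ cong (λ rq → extend 0 (toℕ ∘ finToFun {a} {d} (proj₁ (remQuot {a ^ d} a (proj₁ rq)))) s) rq≡ ⟩
        extend 0 (toℕ ∘ finToFun {a} {d} (proj₁ (remQuot {a ^ d} a (combine (funToFin g) f₀)))) s
          ≡⟨ cong (λ rq → extend 0 (toℕ ∘ finToFun {a} {d} (proj₁ rq)) s) rq′≡ ⟩
        extend 0 (toℕ ∘ finToFun {a} {d} (funToFin g)) s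
          ≡⟨ extend-< 0 _ s<d ⟩
        toℕ (finToFun {a} {d} (funToFin g) (fromℕ< s<d))
          ≡⟨ cong toℕ (finToFun-funToFin g (fromℕ< s<d)) ⟩
        toℕ (g (fromℕ< s<d))
          ≡⟨ toℕ-fromℕ< _ ⟩
        f (suc (toℕ (fromℕ< s<d)))
          ≡⟨ cong (f ∘ suc) (toℕ-fromℕ< s<d) ⟩
        f (suc s) ∎
        where open ≡-Reasoning

  module CriticalGroupOrder (K n′ : ℕ) where

    open Uniqueness (suc K) n′
    open Digits a a+n n′

    representative : Fin (a ^ n′ ℕ.* a ℕ.* a+n) → Divisor N
    representative i u = NF (residue i) (digit i) (toℕ u)

    representative-degree : ∀ i → degree (representative i) ≡ + 0
    representative-degree i = trans (Σℤ≡∑ N (representative i) (NF (residue i) (digit i)) (λ _ → refl)) (∑-NF (residue i) (digit i))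

    laplacian≡Δ-extend : ∀ (z : Fin N → ℤ) u → laplacian E z u ≡ Δ E (extend (+ 0) z) (toℕ u)
    laplacian≡Δ-extend z = laplacian≡Δ E z (extend (+ 0) z) (λ u → sym (extend-toℕ (+ 0) z u)) (hingeEdgesBelow (suc K) (suc (suc n′)))

    representative-injective : ∀ i j → LinEquiv E (representative i) (representative j) → i ≡ j
    representative-injective i j (z , Dᵢ-Dⱼ≡Lz) = digits-injective i j (proj₁ same) (proj₂ same)
      where
      NF-NF≡Δ : ∀ t → t < N → NF (residue i) (digit i) t - NF (residue j) (digit j) t ≡ Δ E (extend (+ 0) z) t
      NF-NF≡Δ t t<N = subst (λ t → NF (residue i) (digit i) t - NF (residue j) (digit j) t ≡ Δ E (extend (+ 0) z) t)
        (toℕ-fromℕ< t<N) (trans (Dᵢ-Dⱼ≡Lz (fromℕ< t<N)) (laplacian≡Δ-extend z (fromℕ< t<N)))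
      same : residue i ≡ residue j × (∀ s → s < suc n′ → digit i s ≡ digit j s)
      same = NF-injective (residue< i) (residue< j) (digit< i) (digit< j) (extend (+ 0) z) NF-NF≡Δ

    representative-complete : ∀ D → degree D ≡ + 0 → ∃ λ i → LinEquiv E D (representative i)
    representative-complete D deg-D≡0 = i , firing ∘ toℕ , D-Dᵢ≡Lz
      where
      F : ℕ → ℤ
      F = extend (+ 0) D
      open Reduction F
      ∑F≡0 : ∑ N F ≡ + 0
      ∑F≡0 = trans (sym (Σℤ≡∑ N D F (λ u → sym (extend-toℕ (+ 0) D u)))) deg-D≡0
      encoded : ∃ λ i → residue i ≡ c × (∀ s → s < suc n′ → digit i s ≡ f s)
      encoded = digits-surjective c< (λ s _ → f< s)
      i : Fin (a ^ n′ ℕ.* a ℕ.* a+n)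
      i = proj₁ encoded
      D-Dᵢ≡Lz : ∀ u → D u - representative i u ≡ laplacian E (firing ∘ toℕ) u
      D-Dᵢ≡Lz u = begin
        D u - NF (residue i) (digit i) (toℕ u)
          ≡⟨ cong₂ _-_ (sym (extend-toℕ (+ 0) D u)) (NF-cong (proj₁ (proj₂ encoded)) (proj₂ (proj₂ encoded)) (toℕ u)) ⟩
        F (toℕ u) - NF c f (toℕ u)   ≡⟨ F-NF≡Δ ∑F≡0 (toℕ u) (toℕ<n u) ⟩
        Δ E firing (toℕ u)           ≡⟨ sym (laplacian≡Δ E (firing ∘ toℕ) firing (λ _ → refl) (hingeEdgesBelow (suc K) (suc (suc n′))) u) ⟩
        laplacian E (firing ∘ toℕ) u ∎
        where open ≡-Reasoning

    hasOrder : CriticalGroupHasOrder N E (a ^ n′ ℕ.* a ℕ.* a+n)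
    hasOrder = representative , representative-degree , representative-injective , representative-complete

open import Data.Nat using (ℕ; suc; _≥_; _+_; _*_; _∸_; _^_; s≤s; z≤n)

theorem3p1 : (k n : ℕ) → k ≥ 3 → n ≥ 2 →
    CriticalGroupHasOrder (hingeSize k n) (hingeEdges k n)
      ((k ∸ 1) ^ (n ∸ 2) * (k ∸ 1) * (k + n ∸ 1))
theorem3p1 (suc (suc (suc K))) (suc (suc n′)) (s≤s (s≤s (s≤s z≤n))) (s≤s (s≤s z≤n)) = CriticalGroupOrder.hasOrder K n′
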